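{- Let $P$ be a set of (non-empty) permutations, $A(x)$ the generating function of $\mathrm{Av}(2413,3142,2314,3124,1\oplus P)$ and $B(x)$ the generating function of $\mathrm{Av}(2413,3142,2314,3124,P)$. Then $A(x)=F_{\mathcal{UDRC}}(x,B(x)-1)$, where $F_{\mathcal{UDRC}}(x,y)=\frac{1-x}{x^2-xy-2x+1}$.
   Context: Permutations, containment and avoidance are classical; $\mathrm{Av}(Q)$ is the set of permutations avoiding every element of $Q$. $1\oplus\pi=1(\pi_1+1)\cdots(\pi_m+1)$ and $1\oplus P=\{1\oplus\pi:\pi\in P\}$. The generating function of a set $\mathcal{C}$ of permutations is $\sum_{n\ge0}|\{\sigma\in\mathcal{C}:|\sigma|=n\}|x^n$ (the empty permutation contributes the constant term). -}

module Defs where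

open import Data.Nat as ℕ using (ℕ; zero; suc; _<_; _∸_)
open import Data.Integer as ℤ using (ℤ; +_; 0ℤ)
open import Data.List using (List; []; _∷_; length; lookup; map; upTo; foldr)
open import Data.List.Relation.Binary.Sublist.Propositional using (_⊆_)
open import Data.List.Relation.Binary.Permutation.Propositional using (_↭_)
open import Data.List.Relation.Unary.Unique.Propositional using (Unique)
open import Data.List.Membership.Propositional using (_∈_)
open import Data.Fin using (Fin; cast)
open import Data.Product using (Σ; ∃-syntax; _×_)
open import Data.Sum using (_⊎_)
open import Relation.Binary.PropositionalEquality using (_≡_)
open import Relation.Nullary using (¬_)

-- Permutations: a permutation of length n is a list of naturals that is
-- a rearrangement of 0,1,...,n-1 (0-based one-line notation).

IsPerm : List ℕ → Set
IsPerm σ = σ ↭ upTo (length σ)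

OrderIso : List ℕ → List ℕ → Set
OrderIso xs ys =
  Σ (length xs ≡ length ys) λ eq → ∀ i j →
    ((lookup xs i < lookup xs j → lookup ys (cast eq i) < lookup ys (cast eq j))
    × (lookup ys (cast eq i) < lookup ys (cast eq j) → lookup xs i < lookup xs j))

Contains : List ℕ → List ℕ → Set
Contains σ π = ∃[ τ ] (τ ⊆ σ × OrderIso τ π)

Av : (List ℕ → Set) → List ℕ → Set
Av Q σ = IsPerm σ × (∀ π → Q π → ¬ Contains σ π)

1⊕ : List ℕ → List ℕ
1⊕ π = 0 ∷ map suc π

p2413 p3142 p2314 p3124 : List ℕ
p2413 = 1 ∷ 3 ∷ 0 ∷ 2 ∷ []
p3142 = 2 ∷ 0 ∷ 3 ∷ 1 ∷ []
p2314 = 1 ∷ 2 ∷ 0 ∷ 3 ∷ []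
p3124 = 2 ∷ 0 ∷ 1 ∷ 3 ∷ []

Base∪ : (List ℕ → Set) → List ℕ → Set
Base∪ R π = π ≡ p2413 ⊎ π ≡ p3142 ⊎ π ≡ p2314 ⊎ π ≡ p3124 ⊎ R π

1⊕Set : (List ℕ → Set) → List ℕ → Set
1⊕Set P π = ∃[ ρ ] (P ρ × π ≡ 1⊕ ρ)

HasCount : (List ℕ → Set) → ℕ → ℕ → Set
HasCount C n k =
  ∃[ L ] (Unique L × length L ≡ k ×
          (∀ σ → ((C σ × length σ ≡ n) → σ ∈ L) × (σ ∈ L → (C σ × length σ ≡ n))))

Series : Set
Series = ℕ → ℤ

sumℤ : List ℤ → ℤ
sumℤ = foldr ℤ._+_ 0ℤ

_⊕ₛ_ _⊖ₛ_ _⊛_ : Series → Series → Series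
(f ⊕ₛ g) n = f n ℤ.+ g n
(f ⊖ₛ g) n = f n ℤ.- g n
(f ⊛ g) n = sumℤ (map (λ k → f k ℤ.* g (n ∸ k)) (upTo (suc n)))

const : ℤ → Series
const c zero = c
const c (suc n) = 0ℤ

X : Series
X (suc zero) = + 1
X _ = 0ℤ

ofℕ : (ℕ → ℕ) → Series
ofℕ a n = + (a n)

F-num : Series
F-num = const (+ 1) ⊖ₛ X

F-den : Series → Series
F-den y = (((X ⊛ X) ⊖ₛ (X ⊛ y)) ⊖ₛ (const (+ 2) ⊛ X)) ⊕ₛ const (+ 1)

-- A nonempty permutation is uniquely a skew sum γ ⊖ β with γ skew-indecomposable. The four
-- basis patterns and every 1 ⊕ ρ are skew-indecomposable, so γ ⊖ β lies in
-- A = Av(2413, 3142, 2314, 3124, 1 ⊕ P) iff γ and β do. A skew-indecomposable permutation of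
-- length ≥ 2 avoiding the basis is a decreasing run ending in its minimum, followed by entries all
-- above it: (k+1 ⋯ 1) ⊕ τ; it avoids 1 ⊕ P iff τ lies in B = Av(2413, 3142, 2314, 3124, P). So
-- a₀ = 1 and aₙ = Σ_{k<n} e_{n-k} a_k with e₁ = 1 and e_j = b₁ + ⋯ + b_{j-1}, that is
-- A(x)(1 − E(x)) = 1, and (1 − x)(1 − E(x)) = x² − x(B(x) − 1) − 2x + 1.

module Submission where

open import Defs

module PowerSeries where

  open import Data.Nat as ℕ using (ℕ; zero; suc; _∸_)
  import Data.Nat.Properties as ℕₚ
  open import Data.Integer using (ℤ; +_; 0ℤ; -_; _+_; _*_; _-_)
  open import Data.Integer.Properties
  open import Data.Integer.Tactic.RingSolver using (solve-∀)
  open import Data.List using (List; []; _∷_; _++_; map; upTo)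
  open import Data.Nat.ListAction using (sum)
  open import Data.List.Properties using (map-applyUpTo; upTo-∷ʳ; map-++)
  open import Data.List.Membership.Propositional using (_∈_)
  open import Data.List.Membership.Propositional.Properties using (∈-upTo⁻)
  open import Data.List.Relation.Unary.Any using (here; there)
  open import Function using (_∘_)
  open import Relation.Binary.PropositionalEquality
  open ≡-Reasoning

  sumℤ-++ : ∀ (xs ys : List ℤ) → sumℤ (xs ++ ys) ≡ sumℤ xs + sumℤ ys
  sumℤ-++ []       ys = sym (+-identityˡ _)
  sumℤ-++ (x ∷ xs) ys = trans (cong (_+_ x) (sumℤ-++ xs ys)) (sym (+-assoc x _ _))

  module _ {f g : ℕ → ℤ} where

    sumℤ-map-cong : ∀ ks → (∀ {k} → k ∈ ks → f k ≡ g k) → sumℤ (map f ks) ≡ sumℤ (map g ks)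
    sumℤ-map-cong []       f≡g = refl
    sumℤ-map-cong (k ∷ ks) f≡g = cong₂ _+_ (f≡g (here refl)) (sumℤ-map-cong ks (f≡g ∘ there))

    sumℤ-map-+ : ∀ ks → sumℤ (map (λ k → f k + g k) ks) ≡ sumℤ (map f ks) + sumℤ (map g ks)
    sumℤ-map-+ []       = refl
    sumℤ-map-+ (k ∷ ks) = trans (cong (_+_ (f k + g k)) (sumℤ-map-+ ks)) (interchange (f k) (g k) _ _)
      where
      interchange : ∀ a b c d → (a + b) + (c + d) ≡ (a + c) + (b + d)
      interchange = solve-∀

  sumℤ-map-neg : ∀ (f : ℕ → ℤ) ks → sumℤ (map (λ k → - f k) ks) ≡ - sumℤ (map f ks)
  sumℤ-map-neg f []       = refl
  sumℤ-map-neg f (k ∷ ks) = trans (cong (_+_ (- f k)) (sumℤ-map-neg f ks)) (sym (neg-distrib-+ (f k) _))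

  sumℤ-map-pos : ∀ (h : ℕ → ℕ) ks → sumℤ (map (λ k → + h k) ks) ≡ + sum (map h ks)
  sumℤ-map-pos h []       = refl
  sumℤ-map-pos h (k ∷ ks) = trans (cong (_+_ (+ h k)) (sumℤ-map-pos h ks)) (sym (pos-+ (h k) _))

  sumℤ-map-0 : ∀ (ks : List ℕ) → sumℤ (map (λ _ → 0ℤ) ks) ≡ 0ℤ
  sumℤ-map-0 []       = refl
  sumℤ-map-0 (k ∷ ks) = cong (_+_ 0ℤ) (sumℤ-map-0 ks)

  sumℤ-upTo-suc : ∀ (f : ℕ → ℤ) n → sumℤ (map f (upTo (suc n))) ≡ f 0 + sumℤ (map (f ∘ suc) (upTo n))
  sumℤ-upTo-suc f n = cong (λ l → f 0 + sumℤ l)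
    (trans (map-applyUpTo suc f n) (sym (map-applyUpTo (λ k → k) (f ∘ suc) n)))

  sumℤ-upTo-∷ʳ : ∀ (f : ℕ → ℤ) n → sumℤ (map f (upTo (suc n))) ≡ sumℤ (map f (upTo n)) + f n
  sumℤ-upTo-∷ʳ f n = begin
    sumℤ (map f (upTo (suc n)))              ≡⟨ cong (sumℤ ∘ map f) (sym (upTo-∷ʳ n)) ⟩
    sumℤ (map f (upTo n ++ n ∷ []))          ≡⟨ cong sumℤ (map-++ f (upTo n) (n ∷ [])) ⟩
    sumℤ (map f (upTo n) ++ f n ∷ [])        ≡⟨ sumℤ-++ (map f (upTo n)) (f n ∷ []) ⟩
    sumℤ (map f (upTo n)) + (f n + 0ℤ)       ≡⟨ cong (_+_ (sumℤ (map f (upTo n)))) (+-identityʳ (f n)) ⟩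
    sumℤ (map f (upTo n)) + f n              ∎

  shift : Series → Series
  shift g zero    = 0ℤ
  shift g (suc j) = g j

  X⊛≗shift : ∀ g n → (X ⊛ g) n ≡ shift g n
  X⊛≗shift g zero    = refl
  X⊛≗shift g (suc m) = begin
    (X ⊛ g) (suc m)
      ≡⟨ sumℤ-upTo-suc (λ k → X k * g (suc m ∸ k)) (suc m) ⟩
    0ℤ + sumℤ (map (λ k → X (suc k) * g (m ∸ k)) (upTo (suc m)))
      ≡⟨ +-identityˡ _ ⟩
    sumℤ (map (λ k → X (suc k) * g (m ∸ k)) (upTo (suc m)))
      ≡⟨ sumℤ-upTo-suc (λ k → X (suc k) * g (m ∸ k)) m ⟩
    + 1 * g m + sumℤ (map (λ k → X (suc (suc k)) * g (m ∸ suc k)) (upTo m))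
      ≡⟨ cong₂ _+_ (*-identityˡ (g m)) (sumℤ-map-0 (upTo m)) ⟩
    g m + 0ℤ
      ≡⟨ +-identityʳ (g m) ⟩
    g m ∎

  const⊛ : ∀ c g n → (const c ⊛ g) n ≡ c * g n
  const⊛ c g n = begin
    (const c ⊛ g) n                      ≡⟨ sumℤ-upTo-suc (λ k → const c k * g (n ∸ k)) n ⟩
    c * g n + sumℤ (map (λ _ → 0ℤ) (upTo n)) ≡⟨ cong (_+_ (c * g n)) (sumℤ-map-0 (upTo n)) ⟩
    c * g n + 0ℤ                          ≡⟨ +-identityʳ _ ⟩
    c * g n                               ∎

  ⊛-⊖ : ∀ f g h n → (f ⊛ (g ⊖ₛ h)) n ≡ (f ⊛ g) n - (f ⊛ h) n
  ⊛-⊖ f g h n = begin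
    sumℤ (map (λ k → f k * (g (n ∸ k) - h (n ∸ k))) ks)
      ≡⟨ sumℤ-map-cong ks (λ {k} _ → distrib (f k) (g (n ∸ k)) (h (n ∸ k))) ⟩
    sumℤ (map (λ k → f k * g (n ∸ k) + - (f k * h (n ∸ k))) ks)
      ≡⟨ sumℤ-map-+ {λ k → f k * g (n ∸ k)} {λ k → - (f k * h (n ∸ k))} ks ⟩
    (f ⊛ g) n + sumℤ (map (λ k → - (f k * h (n ∸ k))) ks)
      ≡⟨ cong (_+_ ((f ⊛ g) n)) (sumℤ-map-neg (λ k → f k * h (n ∸ k)) ks) ⟩
    (f ⊛ g) n - (f ⊛ h) n ∎
    where
    ks = upTo (suc n)
    distrib : ∀ x u v → x * (u - v) ≡ x * u + - (x * v)
    distrib = solve-∀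

  ⊛-shift-suc : ∀ f g n → (f ⊛ shift g) (suc n) ≡ (f ⊛ g) n
  ⊛-shift-suc f g n = begin
    (f ⊛ shift g) (suc n)
      ≡⟨ sumℤ-upTo-∷ʳ (λ k → f k * shift g (suc n ∸ k)) (suc n) ⟩
    sumℤ (map (λ k → f k * shift g (suc n ∸ k)) (upTo (suc n))) + f (suc n) * shift g (suc n ∸ suc n)
      ≡⟨ cong₂ _+_ (sumℤ-map-cong (upTo (suc n)) shifted) (cong (λ m → f (suc n) * shift g m) (ℕₚ.n∸n≡0 n)) ⟩
    (f ⊛ g) n + f (suc n) * 0ℤ
      ≡⟨ cong (_+_ ((f ⊛ g) n)) (*-zeroʳ (f (suc n))) ⟩
    (f ⊛ g) n + 0ℤ
      ≡⟨ +-identityʳ _ ⟩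
    (f ⊛ g) n ∎
    where
    shifted : ∀ {k} → k ∈ upTo (suc n) → f k * shift g (suc n ∸ k) ≡ f k * g (n ∸ k)
    shifted {k} k∈ = cong (λ m → f k * shift g m) (ℕₚ.+-∸-assoc 1 (ℕₚ.≤-pred (∈-upTo⁻ k∈)))

  ⊛-congʳ : ∀ f {g h} → (∀ j → g j ≡ h j) → ∀ n → (f ⊛ g) n ≡ (f ⊛ h) n
  ⊛-congʳ f g≗h n = sumℤ-map-cong (upTo (suc n)) (λ {k} _ → cong (f k *_) (g≗h (n ∸ k)))

  ⊛-shift-zero : ∀ f g → (f ⊛ shift g) 0 ≡ 0ℤ
  ⊛-shift-zero f g = trans (+-identityʳ _) (*-zeroʳ (f 0))

  partialSum : (ℕ → ℕ) → ℕ → ℕ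
  partialSum b zero    = 0
  partialSum b (suc j) = partialSum b j ℕ.+ b (suc j)

  -- the skew-indecomposables of length j in A are 1 (for j = 1) and the (k+1 ⋯ 1) ⊕ τ with τ ∈ B
  indecomposableCount : (ℕ → ℕ) → ℕ → ℕ
  indecomposableCount b zero          = 0
  indecomposableCount b (suc zero)    = 1
  indecomposableCount b (suc (suc j)) = partialSum b (suc j)

  oneMinus : (ℕ → ℕ) → Series
  oneMinus e zero    = + 1
  oneMinus e (suc j) = - + e (suc j)

  F-den-coeff : ∀ y j → F-den y j ≡ ((shift X j - shift y j) - + 2 * X j) + const (+ 1) j
  F-den-coeff y j rewrite X⊛≗shift X j | X⊛≗shift y j | const⊛ (+ 2) X j = refl

  F-den≗oneMinus : ∀ b → let e = indecomposableCount b in b 0 ≡ 1 → ∀ j →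
    F-den (ofℕ b ⊖ₛ const (+ 1)) j ≡ (oneMinus e ⊖ₛ shift (oneMinus e)) j
  F-den≗oneMinus b b0 j = trans (F-den-coeff (ofℕ b ⊖ₛ const (+ 1)) j) (coeff j)
    where
    coeff : ∀ j → ((shift X j - shift (ofℕ b ⊖ₛ const (+ 1)) j) - + 2 * X j) + const (+ 1) j
                ≡ (oneMinus (indecomposableCount b) ⊖ₛ shift (oneMinus (indecomposableCount b))) j
    coeff zero                = refl
    coeff (suc zero)          rewrite b0 = refl
    coeff (suc (suc zero))    = lemma (+ b 1)
      where
      lemma : ∀ β → ((+ 1 - (β - 0ℤ)) - 0ℤ) + 0ℤ ≡ - β - - + 1
      lemma = solve-∀
    coeff (suc (suc (suc j))) rewrite pos-+ (partialSum b (suc j)) (b (suc (suc j))) =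
      lemma (+ partialSum b (suc j)) (+ b (suc (suc j)))
      where
      lemma : ∀ σ β → ((0ℤ - (β - 0ℤ)) - 0ℤ) + 0ℤ ≡ - (σ + β) - - σ
      lemma = solve-∀

  module Recurrence (a e : ℕ → ℕ) (a0 : a 0 ≡ 1)
           (a-rec : ∀ n → a (suc n) ≡ sum (map (λ k → e (suc n ∸ k) ℕ.* a k) (upTo (suc n)))) where

    ofℕ⊛oneMinus-zero : (ofℕ a ⊛ oneMinus e) 0 ≡ + 1
    ofℕ⊛oneMinus-zero rewrite a0 = refl

    ofℕ⊛oneMinus-suc : ∀ n → (ofℕ a ⊛ oneMinus e) (suc n) ≡ 0ℤ
    ofℕ⊛oneMinus-suc n = begin
      (ofℕ a ⊛ oneMinus e) (suc n)
        ≡⟨ sumℤ-upTo-∷ʳ (λ k → + a k * oneMinus e (suc n ∸ k)) (suc n) ⟩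
      sumℤ (map (λ k → + a k * oneMinus e (suc n ∸ k)) ks) + + a (suc n) * oneMinus e (suc n ∸ suc n)
        ≡⟨ cong₂ _+_ (sumℤ-map-cong ks negated) (cong (λ m → + a (suc n) * oneMinus e m) (ℕₚ.n∸n≡0 n)) ⟩
      sumℤ (map (λ k → - + (e (suc n ∸ k) ℕ.* a k)) ks) + + a (suc n) * + 1
        ≡⟨ cong (_+ + a (suc n) * + 1) (sumℤ-map-neg (λ k → + (e (suc n ∸ k) ℕ.* a k)) ks) ⟩
      - sumℤ (map (λ k → + (e (suc n ∸ k) ℕ.* a k)) ks) + + a (suc n) * + 1
        ≡⟨ cong (λ s → - s + + a (suc n) * + 1) (sumℤ-map-pos (λ k → e (suc n ∸ k) ℕ.* a k) ks) ⟩
      - + sum (map (λ k → e (suc n ∸ k) ℕ.* a k) ks) + + a (suc n) * + 1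
        ≡⟨ cong (λ s → - + s + + a (suc n) * + 1) (sym (a-rec n)) ⟩
      - + a (suc n) + + a (suc n) * + 1
        ≡⟨ cancel (+ a (suc n)) ⟩
      0ℤ ∎
      where
      ks = upTo (suc n)
      negated : ∀ {k} → k ∈ ks → + a k * oneMinus e (suc n ∸ k) ≡ - + (e (suc n ∸ k) ℕ.* a k)
      negated {k} k∈ rewrite ℕₚ.+-∸-assoc 1 (ℕₚ.≤-pred (∈-upTo⁻ k∈)) =
        trans (sym (neg-distribʳ-* (+ a k) _))
              (cong -_ (trans (sym (pos-* (a k) _)) (cong +_ (ℕₚ.*-comm (a k) _))))
      cancel : ∀ α → - α + α * + 1 ≡ 0ℤ
      cancel = solve-∀

  ofℕ⊛F-den≡F-num : ∀ a b → a 0 ≡ 1 → b 0 ≡ 1 →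
    (∀ n → a (suc n) ≡ sum (map (λ k → indecomposableCount b (suc n ∸ k) ℕ.* a k) (upTo (suc n)))) →
    ∀ n → (ofℕ a ⊛ F-den (ofℕ b ⊖ₛ const (+ 1))) n ≡ F-num n
  ofℕ⊛F-den≡F-num a b a0 b0 a-rec n = begin
    (ofℕ a ⊛ F-den (ofℕ b ⊖ₛ const (+ 1))) n ≡⟨ ⊛-congʳ (ofℕ a) (F-den≗oneMinus b b0) n ⟩
    (ofℕ a ⊛ (c ⊖ₛ shift c)) n               ≡⟨ ⊛-⊖ (ofℕ a) c (shift c) n ⟩
    (ofℕ a ⊛ c) n - (ofℕ a ⊛ shift c) n      ≡⟨ coeff n ⟩
    F-num n                                  ∎
    where
    e = indecomposableCount b
    c = oneMinus e
    open Recurrence a e a0 a-rec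
    coeff : ∀ n → (ofℕ a ⊛ c) n - (ofℕ a ⊛ shift c) n ≡ F-num n
    coeff zero          = cong₂ _-_ ofℕ⊛oneMinus-zero (⊛-shift-zero (ofℕ a) c)
    coeff (suc zero)    = cong₂ _-_ (ofℕ⊛oneMinus-suc 0)
                            (trans (⊛-shift-suc (ofℕ a) c 0) ofℕ⊛oneMinus-zero)
    coeff (suc (suc n)) = cong₂ _-_ (ofℕ⊛oneMinus-suc (suc n))
                            (trans (⊛-shift-suc (ofℕ a) c (suc n)) (ofℕ⊛oneMinus-suc n))

module PatternAvoidance where

  open import Data.Nat using (ℕ; zero; suc; _+_; _*_; _∸_; _<_; _≤_; z≤n; s≤s; _<?_; _≟_)
  open import Data.Nat.ListAction using (sum)
  open PowerSeries using (partialSum; indecomposableCount)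
  open import Data.Nat.Properties
  open import Data.Fin as Fin using (cast)
  open import Data.List using (List; []; _∷_; _++_; length; map; upTo; downFrom; concatMap; lookup; zip; filter)
  open import Data.List.Properties
  open import Data.List.Extrema ≤-totalOrder using (max; ⊥≤max; xs≤max; argmax-sel)
  open import Data.List.Relation.Unary.All as All using (All; []; _∷_)
  import Data.List.Relation.Unary.All.Properties as All
  open import Data.List.Relation.Unary.Any using (here; there)
  open import Data.List.Relation.Unary.AllPairs as AllPairs using (AllPairs; []; _∷_)
  import Data.List.Relation.Unary.AllPairs.Properties as AllPairs
  open import Data.List.Relation.Unary.Unique.Propositional using (Unique)
  import Data.List.Relation.Unary.Unique.Propositional.Properties as Unique
  open import Data.List.Membership.Propositional using (_∈_; find; lose)
  open import Data.List.Membership.Propositional.Properties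
  open import Data.List.Membership.DecPropositional _≟_ using (_∈?_)
  open import Data.List.Membership.Propositional.Properties.WithK using (unique∧set⇒bag)
  open import Data.List.Relation.Binary.BagAndSetEquality using (∼bag⇒↭)
  open import Data.List.Relation.Binary.Permutation.Propositional using (_↭_; ↭-sym; ↭⇒↭ₛ)
  import Data.List.Relation.Binary.Permutation.Setoid.Properties as Permutationₛ
  open import Data.List.Relation.Binary.Permutation.Propositional.Properties using (Any-resp-↭; All-resp-↭; ↭-length; ++-comm)
  open import Data.List.Relation.Binary.Sublist.Propositional using (_⊆_; []; _∷_; _∷ʳ_)
  open import Data.Product using (_×_; _,_; proj₁; proj₂; ∃; ∃₂; map₁; map₂; uncurry)
  open import Data.Sum using (_⊎_; inj₁; inj₂)
  open import Data.Empty using (⊥; ⊥-elim)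
  open import Function using (_∘_; _$_; mk⇔; case_of_)
  open import Relation.Nullary using (¬_; Dec; yes; no; ¬?; _→-dec_)
  open import Relation.Nullary.Decidable using (True; toWitness)
  open import Relation.Binary.PropositionalEquality
  open import Relation.Binary.Definitions using (tri<; tri≈; tri>)

  module _ {A : Set} {R : A → A → Set} where

    AllPairs-++⁻ : ∀ (xs : List A) {ys} → AllPairs R (xs ++ ys) →
                   AllPairs R xs × AllPairs R ys × All (λ x → All (R x) ys) xs
    AllPairs-++⁻ []       rys         = [] , rys , []
    AllPairs-++⁻ (x ∷ xs) (rx ∷ rxys) with AllPairs-++⁻ xs rxys
    ... | rxs , rys , rxsys = All.++⁻ˡ xs rx ∷ rxs , rys , All.++⁻ʳ xs rx ∷ rxsys

  ≢[]⇒1≤length : ∀ {A : Set} {xs : List A} → xs ≢ [] → 1 ≤ length xs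
  ≢[]⇒1≤length {xs = []}    xs≢[] = ⊥-elim (xs≢[] refl)
  ≢[]⇒1≤length {xs = _ ∷ _} _     = s≤s z≤n

  unique-≋⇒length-≡ : ∀ {A : Set} {xs ys : List A} → Unique xs → Unique ys →
                       (∀ {x} → x ∈ xs → x ∈ ys) → (∀ {x} → x ∈ ys → x ∈ xs) → length xs ≡ length ys
  unique-≋⇒length-≡ uxs uys to from = ↭-length (∼bag⇒↭ (unique∧set⇒bag uxs uys (mk⇔ to from)))

  unique-⊆⇒length-≤ : ∀ {xs ys : List ℕ} → Unique xs → Unique ys → (∀ {x} → x ∈ xs → x ∈ ys) →
                      length xs ≤ length ys
  unique-⊆⇒length-≤ {xs} {ys} uxs uys xs⊆ys = begin
    length xs                   ≡⟨ unique-≋⇒length-≡ uxs (Unique.filter⁺ (_∈? xs) uys) to from ⟩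
    length (filter (_∈? xs) ys) ≤⟨ length-filter (_∈? xs) ys ⟩
    length ys                   ∎
    where
    open ≤-Reasoning
    to : ∀ {x} → x ∈ xs → x ∈ filter (_∈? xs) ys
    to x∈xs = ∈-filter⁺ (_∈? xs) (xs⊆ys x∈xs) x∈xs
    from : ∀ {x} → x ∈ filter (_∈? xs) ys → x ∈ xs
    from = proj₂ ∘ ∈-filter⁻ (_∈? xs) {xs = ys}

  unique-<⇒length-≤ : ∀ {n} {xs : List ℕ} → Unique xs → All (_< n) xs → length xs ≤ n
  unique-<⇒length-≤ {n} uxs xs<n =
    subst (_ ≤_) (length-upTo n) (unique-⊆⇒length-≤ uxs (Unique.upTo⁺ n) (∈-upTo⁺ ∘ All.lookup xs<n))

  unique-<-length⇒∈ : ∀ {n v} {xs : List ℕ} → Unique xs → All (_< n) xs → length xs ≡ n → v < n → v ∈ xs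
  unique-<-length⇒∈ {v = v} {xs} uxs xs<n refl v<n with v ∈? xs
  ... | yes v∈xs = v∈xs
  ... | no  v∉xs = ⊥-elim (<-irrefl refl (unique-<⇒length-≤ (v∉xs′ ∷ uxs) (v<n ∷ xs<n)))
    where
    v∉xs′ : All (v ≢_) xs
    v∉xs′ = All.tabulate λ x∈xs v≡x → v∉xs (subst (_∈ xs) (sym v≡x) x∈xs)

  IsPerm′ : List ℕ → Set
  IsPerm′ σ = Unique σ × All (_< length σ) σ

  IsPerm′⇒∈ : ∀ {σ} → IsPerm′ σ → ∀ {v} → v < length σ → v ∈ σ
  IsPerm′⇒∈ (u , σ<n) = unique-<-length⇒∈ u σ<n refl

  IsPerm⇒IsPerm′ : ∀ {σ} → IsPerm σ → IsPerm′ σ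
  IsPerm⇒IsPerm′ σ↭ =
    Permutationₛ.Unique-resp-↭ (setoid ℕ) (↭⇒↭ₛ (↭-sym σ↭)) (Unique.upTo⁺ _) ,
    All.tabulate (∈-upTo⁻ ∘ Any-resp-↭ σ↭)

  IsPerm′⇒IsPerm : ∀ {σ} → IsPerm′ σ → IsPerm σ
  IsPerm′⇒IsPerm (u , σ<n) = ∼bag⇒↭ (unique∧set⇒bag u (Unique.upTo⁺ _)
    (mk⇔ (∈-upTo⁺ ∘ All.lookup σ<n) (IsPerm′⇒∈ (u , σ<n) ∘ ∈-upTo⁻)))

  Above Below : List ℕ → List ℕ → Set
  Above xs ys = All (λ x → All (_< x) ys) xs
  Below xs ys = All (λ x → All (x <_) ys) xs

  Decreasing : List ℕ → Set
  Decreasing = AllPairs (λ x y → y < x)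

  below-split : ∀ lo {hi} → IsPerm′ (lo ++ hi) → Below lo hi → All (_< length lo) lo × All (length lo ≤_) hi
  below-split lo {hi} (u , lohi<n) lo<hi = All.tabulate lo-small , All.tabulate hi-large
    where
    ulo = proj₁ (AllPairs-++⁻ lo u)
    hi-large : ∀ {y} → y ∈ hi → length lo ≤ y
    hi-large y∈hi = unique-<⇒length-≤ ulo (All.map (λ x<hi → All.lookup x<hi y∈hi) lo<hi)
    lo-small : ∀ {x} → x ∈ lo → x < length lo
    lo-small {x} x∈lo = begin-strict
      x                     <⟨ n<1+n x ⟩
      suc x                 ≡⟨ length-upTo (suc x) ⟨
      length (upTo (suc x)) ≤⟨ unique-⊆⇒length-≤ (Unique.upTo⁺ (suc x)) ulo (∈lo ∘ ∈-upTo⁻) ⟩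
      length lo             ∎
      where
      open ≤-Reasoning
      x<n = All.lookup lohi<n (∈-++⁺ˡ x∈lo)
      ∈lo : ∀ {v} → v < suc x → v ∈ lo
      ∈lo {v} v≤x with ∈-++⁻ lo (IsPerm′⇒∈ (u , lohi<n) (≤-<-trans (≤-pred v≤x) x<n))
      ... | inj₁ v∈lo = v∈lo
      ... | inj₂ v∈hi = ⊥-elim (<⇒≱ (All.lookup (All.lookup lo<hi x∈lo) v∈hi) (≤-pred v≤x))

  decreasing⇒downFrom : ∀ xs → Decreasing xs → IsPerm′ xs → xs ≡ downFrom (length xs)
  decreasing⇒downFrom []       _          _ = refl
  decreasing⇒downFrom (x ∷ xs) (x>xs ∷ d) p@(_ ∷ uxs , _) with IsPerm′⇒∈ p (n<1+n (length xs))
  ... | here refl  = cong (x ∷_) (decreasing⇒downFrom xs d (uxs , x>xs))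
  ... | there n∈xs = ⊥-elim (<-irrefl refl (<-≤-trans (All.lookup x>xs n∈xs) (≤-pred (All.head (proj₂ p)))))

  ⊕-components : ∀ lo {hi} → IsPerm′ (lo ++ hi) → Below lo hi →
                 IsPerm′ lo × ∃ λ τ → hi ≡ map (length lo +_) τ × IsPerm′ τ
  ⊕-components lo {hi} p@(u , lohi<n) below =
    (ulo , lo<) , τ , hi≡ , Unique.map⁻ (subst Unique hi≡ uhi) , τ<
    where
    ulo×uhi = AllPairs-++⁻ lo u
    ulo = proj₁ ulo×uhi
    uhi = proj₁ (proj₂ ulo×uhi)
    lo< = proj₁ (below-split lo p below)
    lo≤ = proj₂ (below-split lo p below)
    τ = map (_∸ length lo) hi
    hi≡ : hi ≡ map (length lo +_) τ
    hi≡ = trans (sym (map-id hi)) (trans (map-cong-local (All.map (sym ∘ m+[n∸m]≡n) lo≤)) (map-∘ hi))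
    τ< : All (_< length τ) τ
    τ< = subst (λ n → All (_< n) τ) (sym (length-map _ hi)) (All.map⁺ (All.zipWith shrink (lo≤ , All.++⁻ʳ lo lohi<n)))
      where
      shrink : ∀ {h} → length lo ≤ h × h < length (lo ++ hi) → h ∸ length lo < length hi
      shrink {h} (lo≤h , h<n) = subst (h ∸ length lo <_)
        (trans (cong (_∸ length lo) (length-++ lo)) (m+n∸m≡n (length lo) _)) (∸-monoˡ-< h<n lo≤h)

  -- Pattern containment

  SameOrder : ℕ × ℕ → ℕ × ℕ → Set
  SameOrder (a , b) (a′ , b′) =
    ((a < a′ → b < b′) × (b < b′ → a < a′)) × ((a′ < a → b′ < b) × (b′ < b → a′ < a))

  -- Occ σ Z: the first components of Z form a subsequence of σ; the second
  -- components are the pattern entries they are matched with.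
  data Occ : List ℕ → List (ℕ × ℕ) → Set where
    []   : Occ [] []
    skip : ∀ {x σ Z} → Occ σ Z → Occ (x ∷ σ) Z
    keep : ∀ {x y σ Z} → Occ σ Z → Occ (x ∷ σ) ((x , y) ∷ Z)

  Contains′ : List ℕ → List ℕ → Set
  Contains′ σ π = ∃ λ Z → Occ σ Z × map proj₂ Z ≡ π × AllPairs SameOrder Z

  private
    occ-zip : ∀ {τ σ : List ℕ} π → τ ⊆ σ → length τ ≡ length π → Occ σ (zip τ π)
    occ-zip []      []          _  = []
    occ-zip π       (_ ∷ʳ τ⊆σ)  eq = skip (occ-zip π τ⊆σ eq)
    occ-zip (_ ∷ π) (refl ∷ τ⊆σ) eq = keep (occ-zip π τ⊆σ (suc-injective eq))

    map-proj₂-zip : ∀ (τ π : List ℕ) → length τ ≡ length π → map proj₂ (zip τ π) ≡ π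
    map-proj₂-zip []      []      _  = refl
    map-proj₂-zip (_ ∷ τ) (y ∷ π) eq = cong (y ∷_) (map-proj₂-zip τ π (suc-injective eq))

    sameOrder-zip : ∀ x y (τ π : List ℕ) (eq : length τ ≡ length π) →
      (∀ i → SameOrder (x , y) (lookup τ i , lookup π (cast eq i))) → All (SameOrder (x , y)) (zip τ π)
    sameOrder-zip x y []      []      eq same = []
    sameOrder-zip x y (_ ∷ τ) (_ ∷ π) eq same = same Fin.zero ∷ sameOrder-zip x y τ π (suc-injective eq) (same ∘ Fin.suc)

    orderIso⇒sameOrder : ∀ (τ π : List ℕ) → OrderIso τ π → AllPairs SameOrder (zip τ π)
    orderIso⇒sameOrder []      []      _        = []
    orderIso⇒sameOrder (x ∷ τ) (y ∷ π) (eq , f) =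
      sameOrder-zip x y τ π (suc-injective eq) (λ i → f Fin.zero (Fin.suc i) , f (Fin.suc i) Fin.zero)
      ∷ orderIso⇒sameOrder τ π (suc-injective eq , λ i j → f (Fin.suc i) (Fin.suc j))

    occ⇒⊆ : ∀ {σ Z} → Occ σ Z → map proj₁ Z ⊆ σ
    occ⇒⊆ []       = []
    occ⇒⊆ (skip o) = _ ∷ʳ occ⇒⊆ o
    occ⇒⊆ (keep o) = refl ∷ occ⇒⊆ o

    sameOrder-lookup : ∀ z Z → All (SameOrder z) Z → (eq : length (map proj₁ Z) ≡ length (map proj₂ Z)) →
      ∀ j → SameOrder z (lookup (map proj₁ Z) j , lookup (map proj₂ Z) (cast eq j))
    sameOrder-lookup z (_ ∷ Z) (s ∷ _)    eq Fin.zero    = s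
    sameOrder-lookup z (_ ∷ Z) (_ ∷ same) eq (Fin.suc j) = sameOrder-lookup z Z same (suc-injective eq) j

    sameOrder⇒orderIso : ∀ Z → AllPairs SameOrder Z → (eq : length (map proj₁ Z) ≡ length (map proj₂ Z)) →
      ∀ i j → let τ = map proj₁ Z; π = map proj₂ Z in
      (lookup τ i < lookup τ j → lookup π (cast eq i) < lookup π (cast eq j)) ×
      (lookup π (cast eq i) < lookup π (cast eq j) → lookup τ i < lookup τ j)
    sameOrder⇒orderIso (w ∷ Z) (_ ∷ _)    eq Fin.zero    Fin.zero    = ⊥-elim ∘ <-irrefl refl , ⊥-elim ∘ <-irrefl refl
    sameOrder⇒orderIso (w ∷ Z) (s ∷ _)    eq Fin.zero    (Fin.suc j) = proj₁ (sameOrder-lookup w Z s (suc-injective eq) j)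
    sameOrder⇒orderIso (w ∷ Z) (s ∷ _)    eq (Fin.suc i) Fin.zero    = proj₂ (sameOrder-lookup w Z s (suc-injective eq) i)
    sameOrder⇒orderIso (w ∷ Z) (_ ∷ same) eq (Fin.suc i) (Fin.suc j) = sameOrder⇒orderIso Z same (suc-injective eq) i j

  Contains⇒Contains′ : ∀ {σ π} → Contains σ π → Contains′ σ π
  Contains⇒Contains′ {π = π} (τ , τ⊆σ , iso) =
    zip τ π , occ-zip π τ⊆σ (proj₁ iso) , map-proj₂-zip τ π (proj₁ iso) , orderIso⇒sameOrder τ π iso

  Contains′⇒Contains : ∀ {σ π} → Contains′ σ π → Contains σ π
  Contains′⇒Contains (Z , o , refl , same) = map proj₁ Z , occ⇒⊆ o , eq , sameOrder⇒orderIso Z same eq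
    where eq = trans (length-map proj₁ Z) (sym (length-map proj₂ Z))

  Av′ : (List ℕ → Set) → List ℕ → Set
  Av′ Q σ = IsPerm′ σ × (∀ π → Q π → ¬ Contains′ σ π)

  Av⇒Av′ : ∀ {Q σ} → Av Q σ → Av′ Q σ
  Av⇒Av′ (p , avoids) = IsPerm⇒IsPerm′ p , λ π q → avoids π q ∘ Contains′⇒Contains

  Av′⇒Av : ∀ {Q σ} → Av′ Q σ → Av Q σ
  Av′⇒Av (p , avoids) = IsPerm′⇒IsPerm p , λ π q → avoids π q ∘ Contains⇒Contains′

  occ-[] : ∀ σ → Occ σ []
  occ-[] []      = []
  occ-[] (_ ∷ σ) = skip (occ-[] σ)

  occ-++ : ∀ {A B Z₁ Z₂} → Occ A Z₁ → Occ B Z₂ → Occ (A ++ B) (Z₁ ++ Z₂)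
  occ-++ []       o₂ = o₂
  occ-++ (skip o) o₂ = skip (occ-++ o o₂)
  occ-++ (keep o) o₂ = keep (occ-++ o o₂)

  occ-split : ∀ A {B Z} → Occ (A ++ B) Z → ∃₂ λ Z₁ Z₂ → Z ≡ Z₁ ++ Z₂ × Occ A Z₁ × Occ B Z₂
  occ-split []      o = [] , _ , refl , [] , o
  occ-split (_ ∷ A) (skip o) with occ-split A o
  ... | Z₁ , Z₂ , refl , o₁ , o₂ = Z₁ , Z₂ , refl , skip o₁ , o₂
  occ-split (x ∷ A) (keep {y = y} o) with occ-split A o
  ... | Z₁ , Z₂ , refl , o₁ , o₂ = (x , y) ∷ Z₁ , Z₂ , refl , keep o₁ , o₂

  occ-∈ : ∀ {A Z} → Occ A Z → All (λ z → proj₁ z ∈ A) Z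
  occ-∈ []       = []
  occ-∈ (skip o) = All.map there (occ-∈ o)
  occ-∈ (keep o) = here refl ∷ All.map there (occ-∈ o)

  occ-AllPairs : ∀ {R : ℕ → ℕ → Set} {A Z} → Occ A Z → AllPairs R A → AllPairs (λ z w → R (proj₁ z) (proj₁ w)) Z
  occ-AllPairs []       _          = []
  occ-AllPairs (skip o) (_ ∷ rs)   = occ-AllPairs o rs
  occ-AllPairs (keep o) (rx ∷ rs)  = All.map (All.lookup rx) (occ-∈ o) ∷ occ-AllPairs o rs

  occ-length : ∀ {σ Z} → Occ σ Z → length Z ≤ length σ
  occ-length []       = z≤n
  occ-length (skip o) = m≤n⇒m≤1+n (occ-length o)
  occ-length (keep o) = s≤s (occ-length o)

  occ-shift⁺ : ∀ c {γ Z} → Occ γ Z → Occ (map (c +_) γ) (map (map₁ (c +_)) Z)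
  occ-shift⁺ c []       = []
  occ-shift⁺ c (skip o) = skip (occ-shift⁺ c o)
  occ-shift⁺ c (keep o) = keep (occ-shift⁺ c o)

  occ-shift⁻ : ∀ c γ {Z} → Occ (map (c +_) γ) Z → ∃ λ Z₀ → Occ γ Z₀ × Z ≡ map (map₁ (c +_)) Z₀
  occ-shift⁻ c []      []       = [] , [] , refl
  occ-shift⁻ c (_ ∷ γ) (skip o) with occ-shift⁻ c γ o
  ... | Z₀ , o₀ , refl = Z₀ , skip o₀ , refl
  occ-shift⁻ c (x ∷ γ) (keep {y = y} o) with occ-shift⁻ c γ o
  ... | Z₀ , o₀ , refl = (x , y) ∷ Z₀ , keep o₀ , refl

  occ-map₂⁺ : ∀ (f : ℕ → ℕ) {σ Z} → Occ σ Z → Occ σ (map (map₂ f) Z)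
  occ-map₂⁺ f []       = []
  occ-map₂⁺ f (skip o) = skip (occ-map₂⁺ f o)
  occ-map₂⁺ f (keep o) = keep (occ-map₂⁺ f o)

  occ-map₂⁻ : ∀ (f : ℕ → ℕ) {σ Z} → Occ σ (map (map₂ f) Z) → Occ σ Z
  occ-map₂⁻ f {σ}     {[]}    _        = occ-[] σ
  occ-map₂⁻ f {_ ∷ _} {_ ∷ _} (skip o) = skip (occ-map₂⁻ f o)
  occ-map₂⁻ f {_ ∷ _} {_ ∷ _} (keep o) = keep (occ-map₂⁻ f o)

  module _ (c : ℕ) {z w : ℕ × ℕ} where

    sameOrder-shift₁⁺ : SameOrder z w → SameOrder (map₁ (c +_) z) (map₁ (c +_) w)
    sameOrder-shift₁⁺ ((f , g) , (h , k)) =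
      ((f ∘ +-cancelˡ-< c _ _) , (+-monoʳ-< c ∘ g)) , ((h ∘ +-cancelˡ-< c _ _) , (+-monoʳ-< c ∘ k))

    sameOrder-shift₁⁻ : SameOrder (map₁ (c +_) z) (map₁ (c +_) w) → SameOrder z w
    sameOrder-shift₁⁻ ((f , g) , (h , k)) =
      ((f ∘ +-monoʳ-< c) , (+-cancelˡ-< c _ _ ∘ g)) , ((h ∘ +-monoʳ-< c) , (+-cancelˡ-< c _ _ ∘ k))

    sameOrder-shift₂⁺ : SameOrder z w → SameOrder (map₂ (c +_) z) (map₂ (c +_) w)
    sameOrder-shift₂⁺ ((f , g) , (h , k)) =
      ((+-monoʳ-< c ∘ f) , (g ∘ +-cancelˡ-< c _ _)) , ((+-monoʳ-< c ∘ h) , (k ∘ +-cancelˡ-< c _ _))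

    sameOrder-shift₂⁻ : SameOrder (map₂ (c +_) z) (map₂ (c +_) w) → SameOrder z w
    sameOrder-shift₂⁻ ((f , g) , (h , k)) =
      ((+-cancelˡ-< c _ _ ∘ f) , (g ∘ +-monoʳ-< c)) , ((+-cancelˡ-< c _ _ ∘ h) , (k ∘ +-monoʳ-< c))

  map-proj₂-map₁ : ∀ (f : ℕ → ℕ) (Z : List (ℕ × ℕ)) → map proj₂ (map (map₁ f) Z) ≡ map proj₂ Z
  map-proj₂-map₁ f Z = sym (map-∘ Z)

  map-proj₂-map₂ : ∀ (f : ℕ → ℕ) (Z : List (ℕ × ℕ)) → map proj₂ (map (map₂ f) Z) ≡ map f (map proj₂ Z)
  map-proj₂-map₂ f Z = trans (sym (map-∘ Z)) (map-∘ Z)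

  contains′-shift⁺ : ∀ c {γ π} → Contains′ γ π → Contains′ (map (c +_) γ) π
  contains′-shift⁺ c (Z , o , refl , same) =
    map (map₁ (c +_)) Z , occ-shift⁺ c o , map-proj₂-map₁ (c +_) Z ,
    AllPairs.map⁺ (AllPairs.map (sameOrder-shift₁⁺ c) same)

  contains′-shift⁻ : ∀ c γ {π} → Contains′ (map (c +_) γ) π → Contains′ γ π
  contains′-shift⁻ c γ (Z , o , refl , same) with occ-shift⁻ c γ o
  ... | Z₀ , o₀ , refl =
    Z₀ , o₀ , sym (map-proj₂-map₁ (c +_) Z₀) , AllPairs.map (sameOrder-shift₁⁻ c) (AllPairs.map⁻ same)

  map-proj₂≡map⁻ : ∀ (f : ℕ → ℕ) (Z : List (ℕ × ℕ)) ρ → map proj₂ Z ≡ map f ρ →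
                   ∃ λ Z₀ → Z ≡ map (map₂ f) Z₀ × map proj₂ Z₀ ≡ ρ
  map-proj₂≡map⁻ f []            []      _  = [] , refl , refl
  map-proj₂≡map⁻ f ((a , _) ∷ Z) (r ∷ ρ) eq with map-proj₂≡map⁻ f Z ρ (∷-injectiveʳ eq) | ∷-injectiveˡ eq
  ... | Z₀ , refl , eq₀ | refl = (a , r) ∷ Z₀ , refl , cong (r ∷_) eq₀

  contains′-shiftPattern⁻ : ∀ c {σ ρ} → Contains′ σ (map (c +_) ρ) → Contains′ σ ρ
  contains′-shiftPattern⁻ c {σ} {ρ} (Z , o , eq , same) with map-proj₂≡map⁻ (c +_) Z ρ eq
  ... | Z₀ , refl , eq₀ = Z₀ , occ-map₂⁻ (c +_) o , eq₀ , AllPairs.map (sameOrder-shift₂⁻ c) (AllPairs.map⁻ same)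

  contains′-tail : ∀ {σ x π} → Contains′ σ (x ∷ π) → Contains′ σ π
  contains′-tail (_ ∷ Z , o , eq , _ ∷ same) = Z , occ-drop o , ∷-injectiveʳ eq , same
    where
    occ-drop : ∀ {σ z Z} → Occ σ (z ∷ Z) → Occ σ Z
    occ-drop (skip o) = skip (occ-drop o)
    occ-drop (keep o) = skip o

  contains′-++ˡ : ∀ {A B π} → Contains′ A π → Contains′ (A ++ B) π
  contains′-++ˡ {B = B} (Z , o , eq , same) = Z , subst (Occ _) (++-identityʳ Z) (occ-++ o (occ-[] B)) , eq , same

  contains′-++ʳ : ∀ A {B π} → Contains′ B π → Contains′ (A ++ B) π
  contains′-++ʳ A (Z , o , eq , same) = Z , occ-++ (occ-[] A) o , eq , same

  contains′-length : ∀ {σ π} → Contains′ σ π → length π ≤ length σ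
  contains′-length (Z , o , refl , _) = ≤-trans (≤-reflexive (length-map proj₂ Z)) (occ-length o)

  -- Sums and skew sums

  AllSplits : (List ℕ → List ℕ → Set) → List ℕ → Set
  AllSplits R π = ∀ π₁ π₂ → π ≡ π₁ ++ π₂ → R π₁ π₂

  SkewIndecomposable : List ℕ → Set
  SkewIndecomposable = AllSplits λ π₁ π₂ → π₁ ≢ [] → π₂ ≢ [] → ¬ Above π₁ π₂

  NoDecreasingSummand : List ℕ → Set
  NoDecreasingSummand = AllSplits λ π₁ π₂ → π₁ ≢ [] → Decreasing π₁ → ¬ Below π₁ π₂

  desc⊕ : ℕ → List ℕ → List ℕ
  desc⊕ k τ = downFrom (suc k) ++ map (suc k +_) τ

  module _ {Z₁ Z₂ : List (ℕ × ℕ)} (same : All (λ z → All (SameOrder z) Z₂) Z₁) where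

    sameOrder-Above : All (λ z → All (λ w → proj₁ w < proj₁ z) Z₂) Z₁ → Above (map proj₂ Z₁) (map proj₂ Z₂)
    sameOrder-Above above =
      All.map⁺ (All.zipWith (λ (s , a) → All.map⁺ (All.zipWith (λ (s , lt) → proj₁ (proj₂ s) lt) (s , a))) (same , above))

    sameOrder-Below : All (λ z → All (λ w → proj₁ z < proj₁ w) Z₂) Z₁ → Below (map proj₂ Z₁) (map proj₂ Z₂)
    sameOrder-Below below =
      All.map⁺ (All.zipWith (λ (s , b) → All.map⁺ (All.zipWith (λ (s , lt) → proj₁ (proj₁ s) lt) (s , b))) (same , below))

  occ-pointwise : ∀ {R : ℕ → ℕ → Set} {A B Z₁ Z₂} → Occ A Z₁ → Occ B Z₂ → All (λ x → All (R x) B) A →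
                  All (λ z → All (λ w → R (proj₁ z) (proj₁ w)) Z₂) Z₁
  occ-pointwise o₁ o₂ rAB = All.map (λ x∈A → All.map (All.lookup (All.lookup rAB x∈A)) (occ-∈ o₂)) (occ-∈ o₁)

  contains′-skew : ∀ A B {π} → Above A B → SkewIndecomposable π → Contains′ (A ++ B) π →
                   Contains′ A π ⊎ Contains′ B π
  contains′-skew A B above indec (Z , o , eq , same) with occ-split A o
  ... | [] , Z₂ , refl , o₁ , o₂ = inj₂ (Z₂ , o₂ , eq , same)
  ... | Z₁@(_ ∷ _) , [] , refl , o₁ , o₂ =
    inj₁ (Z₁ , o₁ , trans (cong (map proj₂) (sym (++-identityʳ Z₁))) eq ,
          subst (AllPairs SameOrder) (++-identityʳ Z₁) same)
  ... | Z₁@(_ ∷ _) , Z₂@(_ ∷ _) , refl , o₁ , o₂ =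
    ⊥-elim (indec (map proj₂ Z₁) (map proj₂ Z₂) (trans (sym eq) (map-++ proj₂ Z₁ Z₂)) (λ ()) (λ ())
      (sameOrder-Above (proj₂ (proj₂ (AllPairs-++⁻ Z₁ same))) (occ-pointwise o₁ o₂ above)))

  contains′-⊕ : ∀ D B {π} → Decreasing D → Below D B → Contains′ (D ++ B) π →
    ∃₂ λ π₁ π₂ → π ≡ π₁ ++ π₂ × Contains′ B π₂ × Decreasing π₁ × Below π₁ π₂
  contains′-⊕ D B dec below (Z , o , eq , same) with occ-split D o
  ... | Z₁ , Z₂ , refl , o₁ , o₂ with AllPairs-++⁻ Z₁ same
  ...   | same₁ , same₂ , same₁₂ =
    map proj₂ Z₁ , map proj₂ Z₂ , trans (sym eq) (map-++ proj₂ Z₁ Z₂) , (Z₂ , o₂ , refl , same₂) ,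
    AllPairs.map⁺ (AllPairs.zipWith (λ (s , lt) → proj₁ (proj₂ s) lt) (same₁ , occ-AllPairs o₁ dec)) ,
    sameOrder-Below same₁₂ (occ-pointwise o₁ o₂ below)

  contains′-⊕⁻ : ∀ D B {π} → Decreasing D → Below D B → NoDecreasingSummand π →
                 Contains′ (D ++ B) π → Contains′ B π
  contains′-⊕⁻ D B dec below noSummand c with contains′-⊕ D B dec below c
  ... | []      , π₂ , refl , c₂ , _ = c₂
  ... | x ∷ π₁ , π₂ , eq   , _  , dec₁ , below₁₂ = ⊥-elim (noSummand (x ∷ π₁) π₂ eq (λ ()) dec₁ below₁₂)

  -- a decreasing prefix of 1 ⊕ ρ has length at most one, since 1 ⊕ ρ starts with its minimum
  contains′-1⊕⁻ : ∀ D B {ρ} → Decreasing D → Below D B → Contains′ (D ++ B) (1⊕ ρ) → Contains′ B ρ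
  contains′-1⊕⁻ D B dec below c with contains′-⊕ D B dec below c
  ... | []          , _ , refl , c₂ , _ = contains′-shiftPattern⁻ 1 (contains′-tail c₂)
  ... | _ ∷ []      , _ , refl , c₂ , _ = contains′-shiftPattern⁻ 1 c₂
  ... | _ ∷ _ ∷ _  , _ , eq   , _ , (y<x ∷ _) ∷ _ , _ with ∷-injectiveˡ eq
  ...   | refl with () ← y<x

  contains′-1⊕⁺ : ∀ k {τ ρ} → Contains′ τ ρ → Contains′ (desc⊕ k τ) (1⊕ ρ)
  contains′-1⊕⁺ k {τ} (Z , o , refl , same) =
    (0 , 0) ∷ Z′ ,
    occ-bottom k (occ-shift⁺ (suc k) (occ-map₂⁺ suc o)) ,
    cong (0 ∷_) (trans (map-proj₂-map₁ (suc k +_) (map (map₂ suc) Z)) (map-proj₂-map₂ suc Z)) ,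
    All.tabulate bottom-sameOrder ∷
    AllPairs.map⁺ (AllPairs.map (sameOrder-shift₁⁺ (suc k)) (AllPairs.map⁺ (AllPairs.map (sameOrder-shift₂⁺ 1) same)))
    where
    Z′ = map (map₁ (suc k +_)) (map (map₂ suc) Z)
    occ-bottom : ∀ k {R y W} → Occ R W → Occ (downFrom (suc k) ++ R) ((0 , y) ∷ W)
    occ-bottom zero    o = keep o
    occ-bottom (suc k) o = skip (occ-bottom k o)
    bottom-sameOrder : ∀ {w} → w ∈ Z′ → SameOrder (0 , 0) w
    bottom-sameOrder w∈ with _ , w∈′ , refl ← ∈-map⁻ (map₁ (suc k +_)) w∈
                        with _ , _ , refl ← ∈-map⁻ (map₂ suc) w∈′ =
      ((λ _ → s≤s z≤n) , (λ _ → s≤s z≤n)) , ((λ ()) , (λ ()))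

  -- The basis and the skew-indecomposable permutations avoiding it

  allSplits? : ∀ {R : List ℕ → List ℕ → Set} → (∀ π₁ π₂ → Dec (R π₁ π₂)) →
               ∀ π → Dec (AllSplits R π)
  allSplits? R? [] with R? [] []
  ... | yes r = yes λ { [] [] refl → r }
  ... | no ¬r = no λ r → ¬r (r [] [] refl)
  allSplits? R? (x ∷ xs) with R? [] (x ∷ xs) | allSplits? (λ π₁ → R? (x ∷ π₁)) xs
  ... | yes r | yes rs = yes λ { [] _ refl → r ; (_ ∷ π₁) π₂ refl → rs π₁ π₂ refl }
  ... | no ¬r | _      = no λ r → ¬r (r [] (x ∷ xs) refl)
  ... | _     | no ¬rs = no λ r → ¬rs λ π₁ π₂ eq → r (x ∷ π₁) π₂ (cong (x ∷_) eq)

  private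
    isNil? : (xs : List ℕ) → Dec (xs ≡ [])
    isNil? []      = yes refl
    isNil? (_ ∷ _) = no λ ()

    above? : ∀ xs ys → Dec (Above xs ys)
    above? xs ys = All.all? (λ x → All.all? (_<? x) ys) xs

    below? : ∀ xs ys → Dec (Below xs ys)
    below? xs ys = All.all? (λ x → All.all? (x <?_) ys) xs

  skewIndecomposable? : ∀ π → Dec (SkewIndecomposable π)
  skewIndecomposable? = allSplits? λ π₁ π₂ → ¬? (isNil? π₁) →-dec ¬? (isNil? π₂) →-dec ¬? (above? π₁ π₂)

  noDecreasingSummand? : ∀ π → Dec (NoDecreasingSummand π)
  noDecreasingSummand? = allSplits? λ π₁ π₂ →
    ¬? (isNil? π₁) →-dec AllPairs.allPairs? (λ x y → y <? x) π₁ →-dec ¬? (below? π₁ π₂)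

  1⊕-skewIndecomposable : ∀ ρ → SkewIndecomposable (1⊕ ρ)
  1⊕-skewIndecomposable ρ []      _       _  π₁≢[] _     _                = π₁≢[] refl
  1⊕-skewIndecomposable ρ (_ ∷ _) []      _  _     π₂≢[] _                = π₂≢[] refl
  1⊕-skewIndecomposable ρ (_ ∷ _) (_ ∷ _) eq _     _     ((y<x ∷ _) ∷ _)
    with refl ← ∷-injectiveˡ eq with () ← y<x

  Basis : List ℕ → Set
  Basis π = π ≡ p2413 ⊎ π ≡ p3142 ⊎ π ≡ p2314 ⊎ π ≡ p3124

  record BasisPattern (π : List ℕ) : Set where
    field
      length≡4            : length π ≡ 4
      entries<4           : All (_< 4) π
      skewIndecomposable  : SkewIndecomposable π
      noDecreasingSummand : NoDecreasingSummand π

  private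
    byEvaluation : ∀ π {l : True (length π ≟ 4)} {e : True (All.all? (_<? 4) π)}
                   {s : True (skewIndecomposable? π)} {n : True (noDecreasingSummand? π)} → BasisPattern π
    byEvaluation π {l} {e} {s} {n} = record
      { length≡4            = toWitness l
      ; entries<4           = toWitness e
      ; skewIndecomposable  = toWitness s
      ; noDecreasingSummand = toWitness n
      }

  basisPattern : ∀ {π} → Basis π → BasisPattern π
  basisPattern (inj₁ refl)                = byEvaluation p2413
  basisPattern (inj₂ (inj₁ refl))         = byEvaluation p3142
  basisPattern (inj₂ (inj₂ (inj₁ refl)))  = byEvaluation p2314
  basisPattern (inj₂ (inj₂ (inj₂ refl)))  = byEvaluation p3124

  module FourValues {w₀ w₁ w₂ w₃ : ℕ} (w₀<w₁ : w₀ < w₁) (w₁<w₂ : w₁ < w₂) (w₂<w₃ : w₂ < w₃) where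

    w : ℕ → ℕ
    w 0 = w₀
    w 1 = w₁
    w 2 = w₂
    w _ = w₃

    w-step : ∀ i → suc i < 4 → w i < w (suc i)
    w-step 0 _ = w₀<w₁
    w-step 1 _ = w₁<w₂
    w-step 2 _ = w₂<w₃
    w-step (suc (suc (suc _))) (s≤s (s≤s (s≤s (s≤s ()))))

    w-mono : ∀ {i j} → i < j → j < 4 → w i < w j
    w-mono {i} {suc j} (s≤s i≤j) j<4 with m≤n⇒m<n∨m≡n i≤j
    ... | inj₁ i<j  = <-trans (w-mono i<j (<-trans (n<1+n j) j<4)) (w-step j j<4)
    ... | inj₂ refl = w-step i j<4

    sameOrder-w : ∀ {i j} → i < 4 → j < 4 → SameOrder (w i , i) (w j , j)
    sameOrder-w {i} {j} i<4 j<4 with <-cmp i j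
    ... | tri< i<j _ _  = ((λ _ → i<j) , (λ _ → w-mono i<j j<4)) ,
                          ((⊥-elim ∘ <-asym (w-mono i<j j<4)) , (⊥-elim ∘ <-asym i<j))
    ... | tri≈ _ refl _ = (irrefl , irrefl) , (irrefl , irrefl)
      where
      irrefl : ∀ {x A} → x < x → A
      irrefl = ⊥-elim ∘ <-irrefl refl
    ... | tri> _ _ j<i  = ((⊥-elim ∘ <-asym (w-mono j<i i<4)) , (⊥-elim ∘ <-asym j<i)) ,
                          ((λ _ → j<i) , (λ _ → w-mono j<i i<4))

    contains′ : ∀ {σ} π → All (_< 4) π → Occ σ (map (λ i → (w i , i)) π) → Contains′ σ π
    contains′ π π<4 o = _ , o , trans (sym (map-∘ π)) (map-id π) , AllPairs.map⁺ (sameOrders π π<4)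
      where
      sameOrders : ∀ π → All (_< 4) π → AllPairs (λ i j → SameOrder (w i , i) (w j , j)) π
      sameOrders []      []          = []
      sameOrders (_ ∷ π) (i<4 ∷ π<4) = All.map (sameOrder-w i<4) π<4 ∷ sameOrders π π<4

  occ-pick : ∀ l {x y R W} → Occ R W → Occ (l ++ x ∷ R) ((x , y) ∷ W)
  occ-pick []      o = keep o
  occ-pick (_ ∷ l) o = skip (occ-pick l o)

  crossing-or-split : ∀ c (xs : List ℕ) →
    (∃₂ λ l₁ x → ∃₂ λ l₂ y → ∃ λ l₃ → xs ≡ l₁ ++ x ∷ l₂ ++ y ∷ l₃ × x ≤ c × c < y) ⊎
    (∃₂ λ xs₁ xs₂ → xs ≡ xs₁ ++ xs₂ × All (c <_) xs₁ × All (_≤ c) xs₂)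
  crossing-or-split c [] = inj₂ ([] , [] , refl , [] , [])
  crossing-or-split c (x ∷ xs) with crossing-or-split c xs
  ... | inj₁ (l₁ , y , l₂ , z , l₃ , refl , y≤c , c<z) = inj₁ (x ∷ l₁ , y , l₂ , z , l₃ , refl , y≤c , c<z)
  ... | inj₂ (xs₁ , xs₂ , refl , c<xs₁ , xs₂≤c) with c <? x
  ...   | yes c<x = inj₂ (x ∷ xs₁ , xs₂ , refl , c<x ∷ c<xs₁ , xs₂≤c)
  ...   | no  c≮x with xs₁ | c<xs₁
  ...     | []       | []      = inj₂ ([] , x ∷ xs₂ , refl , [] , ≮⇒≥ c≮x ∷ xs₂≤c)
  ...     | z ∷ xs₁′ | c<z ∷ _ = inj₁ ([] , x , [] , z , xs₁′ ++ xs₂ , refl , ≮⇒≥ c≮x , c<z)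

  allPairs-positions : ∀ {R : ℕ → ℕ → Set} xs →
    (∀ l₁ x l₂ y l₃ → xs ≡ l₁ ++ x ∷ l₂ ++ y ∷ l₃ → R x y) → AllPairs R xs
  allPairs-positions []       _ = []
  allPairs-positions (x ∷ xs) r =
    All.tabulate (λ y∈xs → let l₂ , l₃ , eq = ∈-∃++ y∈xs in r [] x l₂ _ l₃ (cong (x ∷_) eq)) ∷
    allPairs-positions xs (λ l₁ y l₂ z l₃ eq → r (x ∷ l₁) y l₂ z l₃ (cong (x ∷_) eq))

  -- Split γ = L ++ 0 ∷ R at its minimum. Skew-indecomposability and 2413 force L below max R,
  -- then 3124 and 3142 force L below R, and 2314 forces L to decrease.
  module IndecomposableShape (L : List ℕ) (s : ℕ) (S′ : List ℕ)
    (perm : IsPerm′ (L ++ 0 ∷ s ∷ S′)) (indec : SkewIndecomposable (L ++ 0 ∷ s ∷ S′))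
    (avoids : ∀ π → Basis π → ¬ Contains′ (L ++ 0 ∷ s ∷ S′) π) where

    R : List ℕ
    R = s ∷ S′

    private
      L++0∷R-unique = AllPairs-++⁻ L (proj₁ perm)

    L≢0R : ∀ {x y} → x ∈ L → y ∈ 0 ∷ R → x ≢ y
    L≢0R x∈L = All.lookup (All.lookup (proj₂ (proj₂ L++0∷R-unique)) x∈L)

    L>0 : ∀ {x} → x ∈ L → 0 < x
    L>0 x∈L = n≢0⇒n>0 (L≢0R x∈L (here refl))

    R>0 : ∀ {y} → y ∈ R → 0 < y
    R>0 y∈R = n≢0⇒n>0 (All.lookup (AllPairs.head (proj₁ (proj₂ L++0∷R-unique))) y∈R ∘ sym)

    c : ℕ
    c = max s S′

    c∈R : c ∈ R
    c∈R with argmax-sel (λ x → x) s S′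
    ... | inj₁ c≡s  = here c≡s
    ... | inj₂ c∈S′ = there c∈S′

    R≤c : All (_≤ c) R
    R≤c = ⊥≤max s S′ ∷ xs≤max s S′

    forbidden : ∀ {π σ} → Basis π → L ++ 0 ∷ R ≡ σ → ∀ {a b d} (0<a : 0 < a) (a<b : a < b) (b<d : b < d) →
                ¬ Occ σ (map (λ i → (FourValues.w 0<a a<b b<d i , i)) π)
    forbidden {π} basis refl 0<a a<b b<d o =
      avoids π basis (FourValues.contains′ 0<a a<b b<d π (BasisPattern.entries<4 (basisPattern basis)) o)

    L<c : All (_< c) L
    L<c with crossing-or-split c L | ∈-∃++ c∈R
    ... | inj₁ (l₁ , x , l₂ , y , l₃ , L≡ , x≤c , c<y) | R₁ , R₂ , R≡ =
      ⊥-elim (forbidden (inj₁ refl) (cong₂ (λ L R → L ++ 0 ∷ R) L≡ R≡)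
        (L>0 x∈L) (≤∧≢⇒< x≤c (L≢0R x∈L (there c∈R))) c<y
        (occ-++ (occ-pick l₁ (occ-pick l₂ (occ-[] l₃))) (occ-pick [] (occ-pick R₁ (occ-[] R₂)))))
      where x∈L = subst (x ∈_) (sym L≡) (∈-insert l₁)
    ... | inj₂ ([] , L₂ , L≡ , _ , L₂≤c) | _ =
      All.tabulate λ {x} x∈L → ≤∧≢⇒< (All.lookup L₂≤c (subst (x ∈_) L≡ x∈L)) (L≢0R x∈L (there c∈R))
    ... | inj₂ (x ∷ L₁ , L₂ , L≡ , c<L₁ , L₂≤c) | _ =
      ⊥-elim (indec (x ∷ L₁) (L₂ ++ 0 ∷ R) (trans (cong (_++ 0 ∷ R) L≡) (++-assoc (x ∷ L₁) L₂ (0 ∷ R))) (λ ())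
        (λ eq → case ++-conicalʳ L₂ (0 ∷ R) eq of λ ())
        (All.map (λ c<x → All.map (λ y≤c → ≤-<-trans y≤c c<x) (All.++⁺ L₂≤c (z≤n ∷ R≤c))) c<L₁))

    L<R : ∀ {x y} → x ∈ L → y ∈ R → x < y
    L<R {x} {y} x∈L y∈R with <-cmp x y
    ... | tri< x<y _ _ = x<y
    ... | tri≈ _ x≡y _ = ⊥-elim (L≢0R x∈L (there y∈R) x≡y)
    ... | tri> _ _ y<x with ∈-∃++ x∈L | ∈-∃++ y∈R
    ...   | L₁ , L₂ , L≡ | R₁ , R₂ , R≡ with ∈-++⁻ R₁ (subst (c ∈_) R≡ c∈R)
    ...     | inj₂ (here c≡y) = ⊥-elim (<-asym y<x (subst (x <_) c≡y (All.lookup L<c x∈L)))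
    ...     | inj₂ (there c∈R₂) with R₃ , R₄ , R₂≡ ← ∈-∃++ c∈R₂ = ⊥-elim $
      forbidden (inj₂ (inj₂ (inj₂ refl)))
        (cong₂ (λ L R → L ++ 0 ∷ R) L≡ (trans R≡ (cong (λ R → R₁ ++ y ∷ R) R₂≡)))
        (R>0 y∈R) y<x (All.lookup L<c x∈L)
        (occ-++ (occ-pick L₁ (occ-[] L₂)) (occ-pick [] (occ-pick R₁ (occ-pick R₃ (occ-[] R₄)))))
    ...     | inj₁ c∈R₁ with R₃ , R₄ , R₁≡ ← ∈-∃++ c∈R₁ = ⊥-elim $
      forbidden (inj₂ (inj₁ refl))
        (cong₂ (λ L R → L ++ 0 ∷ R) L≡
          (trans R≡ (trans (cong (_++ y ∷ R₂) R₁≡) (++-assoc R₃ (c ∷ R₄) (y ∷ R₂)))))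
        (R>0 y∈R) y<x (All.lookup L<c x∈L)
        (occ-++ (occ-pick L₁ (occ-[] L₂)) (occ-pick [] (occ-pick R₃ (occ-pick R₄ (occ-[] R₂)))))

    L-decreasing : Decreasing L
    L-decreasing = allPairs-positions L decreasing
      where
      decreasing : ∀ l₁ x l₂ y l₃ → L ≡ l₁ ++ x ∷ l₂ ++ y ∷ l₃ → y < x
      decreasing l₁ x l₂ y l₃ L≡ with <-cmp x y | ∈-∃++ c∈R
      ... | tri> _ _ y<x | _ = y<x
      ... | tri≈ _ x≡y _ | _ = ⊥-elim (All.lookup x∉ (∈-insert l₂) x≡y)
        where
        x∉ = AllPairs.head (proj₁ (proj₂ (AllPairs-++⁻ l₁ (subst Unique L≡ (proj₁ L++0∷R-unique)))))
      ... | tri< x<y _ _ | R₁ , R₂ , R≡ =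
        ⊥-elim (forbidden (inj₂ (inj₂ (inj₁ refl))) (cong₂ (λ L R → L ++ 0 ∷ R) L≡ R≡)
          (L>0 x∈L) x<y (All.lookup L<c y∈L)
          (occ-++ (occ-pick l₁ (occ-pick l₂ (occ-[] l₃))) (occ-pick [] (occ-pick R₁ (occ-[] R₂)))))
        where
        x∈L = subst (x ∈_) (sym L≡) (∈-insert l₁)
        y∈L = subst (y ∈_) (sym L≡) (∈-++⁺ʳ l₁ (there (∈-insert l₂)))

    private
      D : List ℕ
      D = L ++ 0 ∷ []
      γ≡D++R : L ++ 0 ∷ R ≡ D ++ R
      γ≡D++R = sym (++-assoc L (0 ∷ []) R)
      D-decreasing : Decreasing D
      D-decreasing = AllPairs.++⁺ L-decreasing ([] ∷ []) (All.tabulate (λ x∈L → L>0 x∈L ∷ []))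
      D-below-R : Below D R
      D-below-R = All.++⁺ (All.tabulate λ x∈L → All.tabulate (L<R x∈L)) (All.tabulate R>0 ∷ [])

    shape : ∃₂ λ k τ → L ++ 0 ∷ R ≡ desc⊕ k τ × τ ≢ [] × IsPerm′ τ
    shape with ⊕-components D (subst IsPerm′ γ≡D++R perm) D-below-R
    ... | D-perm , τ , R≡ , τ-perm = length L , τ , γ≡desc⊕ , τ≢[] , τ-perm
      where
      open ≡-Reasoning
      γ≡desc⊕ : L ++ 0 ∷ R ≡ desc⊕ (length L) τ
      γ≡desc⊕ = begin
        L ++ 0 ∷ R                                  ≡⟨ γ≡D++R ⟩
        D ++ R                                      ≡⟨ cong₂ _++_ (decreasing⇒downFrom D D-decreasing D-perm) R≡ ⟩
        downFrom (length D) ++ map (length D +_) τ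
          ≡⟨ cong (λ n → downFrom n ++ map (n +_) τ) (trans (length-++ L) (+-comm (length L) 1)) ⟩
        desc⊕ (length L) τ                          ∎
      τ≢[] : τ ≢ []
      τ≢[] τ≡[] with () ← trans R≡ (cong (map (length D +_)) τ≡[])

  indecomposable-shape : ∀ γ → IsPerm′ γ → 2 ≤ length γ → SkewIndecomposable γ →
    (∀ π → Basis π → ¬ Contains′ γ π) →
    ∃₂ λ k τ → γ ≡ desc⊕ k τ × τ ≢ [] × IsPerm′ τ
  indecomposable-shape γ p 2≤γ indec avoids with ∈-∃++ (IsPerm′⇒∈ p {0} (<-≤-trans (s≤s z≤n) 2≤γ))
  ... | []          , []     , refl with s≤s () ← 2≤γ
  ... | L@(_ ∷ _)   , []     , refl = ⊥-elim (indec L (0 ∷ []) refl (λ ()) (λ ())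
    (All.map (λ x≢0 → n≢0⇒n>0 (All.head x≢0) ∷ []) (proj₂ (proj₂ (AllPairs-++⁻ L (proj₁ p))))))
  ... | L           , s ∷ S′ , refl = IndecomposableShape.shape L s S′ p indec avoids

  infixr 5 _⊖_
  _⊖_ : List ℕ → List ℕ → List ℕ
  γ ⊖ β = map (length β +_) γ ++ β

  length-⊖ : ∀ γ β → length (γ ⊖ β) ≡ length γ + length β
  length-⊖ γ β = trans (length-++ (map (length β +_) γ)) (cong (_+ length β) (length-map _ γ))

  above-⊖ : ∀ γ {β} → All (_< length β) β → Above (map (length β +_) γ) β
  above-⊖ γ β<n = All.map⁺ (All.tabulate λ {g} _ → All.map (λ b< → <-≤-trans b< (m≤m+n _ g)) β<n)

  IsPerm′-⊖ : ∀ {γ β} → IsPerm′ γ → IsPerm′ β → IsPerm′ (γ ⊖ β)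
  IsPerm′-⊖ {γ} {β} (uγ , γ<) (uβ , β<) =
    Unique.++⁺ (Unique.map⁺ (+-cancelˡ-≡ (length β) _ _) uγ) uβ disjoint ,
    subst (λ n → All (_< n) (γ ⊖ β)) (sym (length-⊖ γ β))
      (All.++⁺ (All.map⁺ (All.map shifted< γ<)) (All.map (λ b< → <-≤-trans b< (m≤n+m (length β) (length γ))) β<))
    where
    shifted< : ∀ {g} → g < length γ → length β + g < length γ + length β
    shifted< {g} g< = subst (length β + g <_) (+-comm (length β) (length γ)) (+-monoʳ-< (length β) g<)
    disjoint : ∀ {v} → v ∈ map (length β +_) γ × v ∈ β → ⊥
    disjoint (v∈γ′ , v∈β) = <-irrefl refl (All.lookup (All.lookup (above-⊖ γ β<) v∈γ′) v∈β)

  length-desc⊕ : ∀ k τ → length (desc⊕ k τ) ≡ suc k + length τ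
  length-desc⊕ k τ = trans (length-++ (downFrom (suc k))) (cong₂ _+_ (length-downFrom (suc k)) (length-map _ τ))

  desc⊕-injective : ∀ {k k′ τ τ′} → desc⊕ k τ ≡ desc⊕ k′ τ′ → k ≡ k′ × τ ≡ τ′
  desc⊕-injective {k} eq with refl ← ∷-injectiveˡ eq =
    refl , map-injective (+-cancelˡ-≡ (suc k) _ _) (++-cancelˡ (downFrom (suc k)) _ _ eq)

  downFrom-decreasing : ∀ n → Decreasing (downFrom n)
  downFrom-decreasing zero    = []
  downFrom-decreasing (suc n) = All.tabulate ∈-downFrom⁻ ∷ downFrom-decreasing n

  downFrom-below : ∀ k τ → Below (downFrom (suc k)) (map (suc k +_) τ)
  downFrom-below k τ =
    All.tabulate λ x∈ → All.map⁺ (All.tabulate λ {t} _ → <-≤-trans (∈-downFrom⁻ x∈) (m≤m+n (suc k) t))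

  IsPerm′-desc⊕ : ∀ k {τ} → IsPerm′ τ → IsPerm′ (desc⊕ k τ)
  IsPerm′-desc⊕ k {τ} (u , τ<) =
    Unique.++⁺ (Unique.downFrom⁺ (suc k)) (Unique.map⁺ (+-cancelˡ-≡ (suc k) _ _) u)
      (λ (x∈ , y∈) → <-irrefl refl (All.lookup (All.lookup (downFrom-below k τ) x∈) y∈)) ,
    subst (λ n → All (_< n) (desc⊕ k τ)) (sym (length-desc⊕ k τ))
      (All.++⁺ (All.tabulate (λ x∈ → <-≤-trans (∈-downFrom⁻ x∈) (m≤m+n (suc k) _)))
               (All.map⁺ (All.map (+-monoʳ-< (suc k)) τ<)))

  ++-split : ∀ (xs ys xs′ ys′ : List ℕ) → xs ++ ys ≡ xs′ ++ ys′ →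
    (∃ λ mid → xs′ ≡ xs ++ mid × ys ≡ mid ++ ys′) ⊎ (∃ λ mid → xs ≡ xs′ ++ mid × ys′ ≡ mid ++ ys)
  ++-split []       ys xs′       ys′ eq = inj₁ (xs′ , refl , eq)
  ++-split (x ∷ xs) ys []        ys′ eq = inj₂ (x ∷ xs , refl , sym eq)
  ++-split (x ∷ xs) ys (_ ∷ xs′) ys′ eq with refl ← ∷-injectiveˡ eq with ++-split xs ys xs′ ys′ (∷-injectiveʳ eq)
  ... | inj₁ (mid , refl , eq′) = inj₁ (mid , refl , eq′)
  ... | inj₂ (mid , refl , eq′) = inj₂ (mid , refl , eq′)

  map-split : ∀ (f : ℕ → ℕ) γ xs ys → map f γ ≡ xs ++ ys →
              ∃₂ λ γ₁ γ₂ → γ ≡ γ₁ ++ γ₂ × xs ≡ map f γ₁ × ys ≡ map f γ₂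
  map-split f γ       []       ys eq = [] , γ , refl , refl , sym eq
  map-split f (g ∷ γ) (_ ∷ xs) ys eq with refl ← ∷-injectiveˡ eq with map-split f γ xs ys (∷-injectiveʳ eq)
  ... | γ₁ , γ₂ , refl , refl , refl = g ∷ γ₁ , γ₂ , refl , refl , refl

  skewIndecomposable-shift⁺ : ∀ c γ → SkewIndecomposable γ → SkewIndecomposable (map (c +_) γ)
  skewIndecomposable-shift⁺ c γ indec xs ys eq xs≢[] ys≢[] above with map-split (c +_) γ xs ys eq
  ... | γ₁ , γ₂ , γ≡ , refl , refl =
    indec γ₁ γ₂ γ≡ (xs≢[] ∘ cong (map (c +_))) (ys≢[] ∘ cong (map (c +_)))
      (All.map (All.map (+-cancelˡ-< c _ _) ∘ All.map⁻) (All.map⁻ above))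

  skewIndecomposable-shift⁻ : ∀ c γ → SkewIndecomposable (map (c +_) γ) → SkewIndecomposable γ
  skewIndecomposable-shift⁻ c γ indec xs ys eq xs≢[] ys≢[] above =
    indec (map (c +_) xs) (map (c +_) ys) (trans (cong (map (c +_)) eq) (map-++ (c +_) xs ys))
      (xs≢[] ∘ map-[] xs) (ys≢[] ∘ map-[] ys) (All.map⁺ (All.map (All.map⁺ ∘ All.map (+-monoʳ-< c)) above))
    where
    map-[] : ∀ (l : List ℕ) → map (c +_) l ≡ [] → l ≡ []
    map-[] [] _ = refl

  skewIndecomposable-[0] : SkewIndecomposable (0 ∷ [])
  skewIndecomposable-[0] []      _  _  []≢[] _     _ = []≢[] refl
  skewIndecomposable-[0] (_ ∷ _) ys eq _     ys≢[] _ = ys≢[] (++-conicalʳ _ ys (∷-injectiveʳ (sym eq)))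

  -- A split inside the decreasing prefix leaves suc k + t on the right of a smaller
  -- entry; a split after it leaves 0 on the left.
  skewIndecomposable-desc⊕ : ∀ k τ → τ ≢ [] → SkewIndecomposable (desc⊕ k τ)
  skewIndecomposable-desc⊕ k []      τ≢[] = ⊥-elim (τ≢[] refl)
  skewIndecomposable-desc⊕ k (t ∷ τ) _    []       _  _  []≢[] _     _     = []≢[] refl
  skewIndecomposable-desc⊕ k (t ∷ τ) _    (x ∷ xs) ys eq _     ys≢[] above
    with ++-split (x ∷ xs) ys (downFrom (suc k)) (map (suc k +_) (t ∷ τ)) (sym eq)
  ... | inj₁ (mid , D≡ , ys≡) =
    <-asym (All.lookup (All.lookup above (here refl)) (subst (suc k + t ∈_) (sym ys≡) (∈-++⁺ʳ mid (here refl))))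
           (<-≤-trans (∈-downFrom⁻ (subst (x ∈_) (sym D≡) (here refl))) (m≤m+n (suc k) t))
  ... | inj₂ (mid , xs≡ , _) with ys | ys≢[]
  ...   | []    | ys≢[]′ = ys≢[]′ refl
  ...   | y ∷ _ | _
    with () ← All.lookup (All.lookup above (subst (0 ∈_) (sym xs≡) (∈-++⁺ˡ (∈-downFrom⁺ (s≤s z≤n))))) (here refl)

  Base∪-elim : ∀ {R π} → Base∪ R π → Basis π ⊎ R π
  Base∪-elim (inj₁ eq)                         = inj₁ (inj₁ eq)
  Base∪-elim (inj₂ (inj₁ eq))                  = inj₁ (inj₂ (inj₁ eq))
  Base∪-elim (inj₂ (inj₂ (inj₁ eq)))           = inj₁ (inj₂ (inj₂ (inj₁ eq)))
  Base∪-elim (inj₂ (inj₂ (inj₂ (inj₁ eq))))    = inj₁ (inj₂ (inj₂ (inj₂ eq)))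
  Base∪-elim (inj₂ (inj₂ (inj₂ (inj₂ r))))     = inj₂ r

  Base∪-basis : ∀ {R π} → Basis π → Base∪ R π
  Base∪-basis (inj₁ eq)                      = inj₁ eq
  Base∪-basis (inj₂ (inj₁ eq))               = inj₂ (inj₁ eq)
  Base∪-basis (inj₂ (inj₂ (inj₁ eq)))        = inj₂ (inj₂ (inj₁ eq))
  Base∪-basis (inj₂ (inj₂ (inj₂ eq)))        = inj₂ (inj₂ (inj₂ (inj₁ eq)))

  Base∪-extra : ∀ {R π} → R π → Base∪ R π
  Base∪-extra = inj₂ ∘ inj₂ ∘ inj₂ ∘ inj₂

  Av′-short : ∀ {Q σ m} → (∀ {π} → Q π → m ≤ length π) → length σ < m → IsPerm′ σ → Av′ Q σ
  Av′-short long σ<m p = p , λ π q c → <⇒≱ σ<m (≤-trans (long q) (contains′-length c))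

  module Classes (P : List ℕ → Set) (P-nonempty : ∀ ρ → P ρ → ρ ≢ []) where

    QA QB : List ℕ → Set
    QA = Base∪ (1⊕Set P)
    QB = Base∪ P

    QA-skewIndecomposable : ∀ {π} → QA π → SkewIndecomposable π
    QA-skewIndecomposable q with Base∪-elim {1⊕Set P} q
    ... | inj₁ b              = BasisPattern.skewIndecomposable (basisPattern b)
    ... | inj₂ (ρ , _ , refl) = 1⊕-skewIndecomposable ρ

    QA-length : ∀ {π} → QA π → 2 ≤ length π
    QA-length q with Base∪-elim {1⊕Set P} q
    ... | inj₁ b                   = subst (2 ≤_) (sym (BasisPattern.length≡4 (basisPattern b))) (s≤s (s≤s z≤n))
    ... | inj₂ ([]    , Pρ , refl) = ⊥-elim (P-nonempty [] Pρ refl)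
    ... | inj₂ (_ ∷ _ , _  , refl) = s≤s (s≤s z≤n)

    QB-length : ∀ {π} → QB π → 1 ≤ length π
    QB-length {_ ∷ _} _ = s≤s z≤n
    QB-length {[]}    q with Base∪-elim {P} q
    ... | inj₁ b  with () ← BasisPattern.length≡4 (basisPattern b)
    ... | inj₂ Pρ = ⊥-elim (P-nonempty [] Pρ refl)

    Av-desc⊕ : ∀ k {τ} → Av′ QB τ → Av′ QA (desc⊕ k τ)
    Av-desc⊕ k {τ} (τ-perm , τ-avoids) = IsPerm′-desc⊕ k τ-perm , avoids
      where
      avoids : ∀ π → QA π → ¬ Contains′ (desc⊕ k τ) π
      avoids π q c with Base∪-elim {1⊕Set P} q
      ... | inj₁ b = τ-avoids π (Base∪-basis {P} b) (contains′-shift⁻ (suc k) τ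
        (contains′-⊕⁻ (downFrom (suc k)) _ (downFrom-decreasing (suc k)) (downFrom-below k τ)
          (BasisPattern.noDecreasingSummand (basisPattern b)) c))
      ... | inj₂ (ρ , Pρ , refl) = τ-avoids ρ (Base∪-extra {P} Pρ) (contains′-shift⁻ (suc k) τ
        (contains′-1⊕⁻ (downFrom (suc k)) _ (downFrom-decreasing (suc k)) (downFrom-below k τ) c))

    Av-desc⊕⁻ : ∀ k {τ} → Av′ QA (desc⊕ k τ) → IsPerm′ τ → Av′ QB τ
    Av-desc⊕⁻ k (_ , avoids) τ-perm = τ-perm , τ-avoids
      where
      τ-avoids : ∀ π → QB π → ¬ Contains′ _ π
      τ-avoids π q c with Base∪-elim {P} q
      ... | inj₁ b  = avoids π (Base∪-basis {1⊕Set P} b) (contains′-++ʳ (downFrom (suc k)) (contains′-shift⁺ (suc k) c))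
      ... | inj₂ Pπ = avoids (1⊕ π) (Base∪-extra {1⊕Set P} (π , Pπ , refl)) (contains′-1⊕⁺ k c)

    Av-⊖ : ∀ {γ β} → Av′ QA γ → Av′ QA β → Av′ QA (γ ⊖ β)
    Av-⊖ {γ} {β} (γ-perm , γ-avoids) (β-perm , β-avoids) = IsPerm′-⊖ γ-perm β-perm , avoids
      where
      avoids : ∀ π → QA π → ¬ Contains′ (γ ⊖ β) π
      avoids π q c with contains′-skew (map (length β +_) γ) β (above-⊖ γ (proj₂ β-perm)) (QA-skewIndecomposable q) c
      ... | inj₁ c₁ = γ-avoids π q (contains′-shift⁻ (length β) γ c₁)
      ... | inj₂ c₂ = β-avoids π q c₂

    Av-⊖⁻ : ∀ {γ β} → Av′ QA (γ ⊖ β) → IsPerm′ γ → IsPerm′ β → Av′ QA γ × Av′ QA β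
    Av-⊖⁻ {γ} {β} (_ , avoids) γ-perm β-perm =
      (γ-perm , λ π q → avoids π q ∘ contains′-++ˡ ∘ contains′-shift⁺ (length β)) ,
      (β-perm , λ π q → avoids π q ∘ contains′-++ʳ (map (length β +_) γ))

  IsPerm′-resp-↭ : ∀ {xs ys} → xs ↭ ys → IsPerm′ xs → IsPerm′ ys
  IsPerm′-resp-↭ xs↭ys (u , xs<) =
    Permutationₛ.Unique-resp-↭ (setoid ℕ) (↭⇒↭ₛ xs↭ys) u ,
    subst (λ n → All (_< n) _) (↭-length xs↭ys) (All-resp-↭ xs↭ys xs<)

  NoEarlierSkewSplit : List ℕ → List ℕ → Set
  NoEarlierSkewSplit rest = AllSplits λ x₁ x₂ → x₁ ≢ [] → x₂ ≢ [] → ¬ Above x₁ (x₂ ++ rest)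

  FirstSkewSplit : List ℕ → Set
  FirstSkewSplit σ = ∃₂ λ xs ys → σ ≡ xs ++ ys × xs ≢ [] × Above xs ys × NoEarlierSkewSplit ys xs

  firstSkewSplit-from : ∀ acc rest → acc ≢ [] → NoEarlierSkewSplit rest acc → FirstSkewSplit (acc ++ rest)
  firstSkewSplit-from acc []       acc≢[] noEarlier = acc , [] , refl , acc≢[] , All.tabulate (λ _ → []) , noEarlier
  firstSkewSplit-from acc (r ∷ rest) acc≢[] noEarlier with above? acc (r ∷ rest)
  ... | yes above = acc , r ∷ rest , refl , acc≢[] , above , noEarlier
  ... | no ¬above = subst FirstSkewSplit (++-assoc acc (r ∷ []) rest)
                      (firstSkewSplit-from (acc ++ r ∷ []) rest (acc≢[] ∘ ++-conicalˡ acc _) noEarlier′)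
    where
    noEarlier′ : NoEarlierSkewSplit rest (acc ++ r ∷ [])
    noEarlier′ x₁ x₂ eq x₁≢[] x₂≢[] above with ++-split x₁ x₂ acc (r ∷ []) (sym eq)
    ... | inj₁ ([] , acc≡ , x₂≡) =
      ¬above (subst₂ Above (trans (sym (++-identityʳ x₁)) (sym acc≡)) (cong (_++ rest) x₂≡) above)
    ... | inj₁ (m ∷ mid , acc≡ , x₂≡) =
      noEarlier x₁ (m ∷ mid) acc≡ x₁≢[] (λ ())
        (subst (Above x₁) (trans (cong (_++ rest) x₂≡) (++-assoc (m ∷ mid) (r ∷ []) rest)) above)
    ... | inj₂ ([] , x₁≡ , x₂≡) =
      ¬above (subst₂ Above (trans x₁≡ (++-identityʳ acc)) (cong (_++ rest) (sym x₂≡)) above)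
    ... | inj₂ (m ∷ mid , _ , x₂≡) = x₂≢[] (++-conicalʳ mid x₂ (∷-injectiveʳ (sym x₂≡)))

  firstSkewSplit : ∀ s σ → FirstSkewSplit (s ∷ σ)
  firstSkewSplit s σ = firstSkewSplit-from (s ∷ []) σ (λ ()) noEarlier
    where
    noEarlier : NoEarlierSkewSplit σ (s ∷ [])
    noEarlier []       _  _  x₁≢[] _     = ⊥-elim (x₁≢[] refl)
    noEarlier (_ ∷ x₁) x₂ eq _     x₂≢[] = ⊥-elim (x₂≢[] (++-conicalʳ x₁ x₂ (sym (∷-injectiveʳ eq))))

  Above⇒Below : ∀ {xs ys} → Above xs ys → Below ys xs
  Above⇒Below above = All.tabulate λ y∈ys → All.tabulate λ x∈xs → All.lookup (All.lookup above x∈xs) y∈ys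

  noEarlierSkewSplit⇒skewIndecomposable : ∀ {xs ys} → Above xs ys → NoEarlierSkewSplit ys xs → SkewIndecomposable xs
  noEarlierSkewSplit⇒skewIndecomposable {ys = ys} above noEarlier x₁ x₂ xs≡ x₁≢[] x₂≢[] x₁-above-x₂ =
    noEarlier x₁ x₂ xs≡ x₁≢[] x₂≢[]
      (All.zipWith (uncurry All.++⁺) (x₁-above-x₂ , All.++⁻ˡ x₁ (subst (λ X → Above X ys) xs≡ above)))

  skewDecomposition : ∀ s σ → IsPerm′ (s ∷ σ) →
    ∃₂ λ γ β → s ∷ σ ≡ γ ⊖ β × IsPerm′ γ × IsPerm′ β × SkewIndecomposable γ × γ ≢ []
  skewDecomposition s σ p with firstSkewSplit s σ
  ... | xs , ys , σ≡ , xs≢[] , above , noEarlier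
    with ys-perm , γ , xs≡ , γ-perm
           ← ⊕-components ys (IsPerm′-resp-↭ (++-comm xs ys) (subst IsPerm′ σ≡ p)) (Above⇒Below above) =
    γ , ys , trans σ≡ (cong (_++ ys) xs≡) , γ-perm , ys-perm ,
    skewIndecomposable-shift⁻ (length ys) γ
      (subst SkewIndecomposable xs≡ (noEarlierSkewSplit⇒skewIndecomposable above noEarlier)) ,
    xs≢[] ∘ trans xs≡ ∘ cong (map _)

  -- If the shifted γ′ ends strictly inside β, the part of β it covers lies below
  -- the shifted γ, which splits γ′ skew.
  private
    overlap-absurd : ∀ {γ β γ′ c mid β′} → SkewIndecomposable γ′ → IsPerm′ β → γ ≢ [] → mid ≢ [] →
                     map (c +_) γ′ ≡ map (length β +_) γ ++ mid → β ≡ mid ++ β′ → ⊥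
    overlap-absurd {γ} {β} {γ′} {c} {mid} indec (_ , β<) γ≢[] mid≢[] γ′≡ β≡ =
      skewIndecomposable-shift⁺ c γ′ indec (map (length β +_) γ) mid γ′≡ (γ≢[] ∘ map-[] γ) mid≢[]
        (All.map⁺ (All.tabulate λ {g} _ → All.tabulate λ m∈ →
          <-≤-trans (All.lookup β< (subst (_ ∈_) (sym β≡) (∈-++⁺ˡ m∈))) (m≤m+n _ g)))
      where
      map-[] : ∀ (l : List ℕ) → map (length β +_) l ≡ [] → l ≡ []
      map-[] [] _ = refl

  ⊖-injective : ∀ {γ β γ′ β′} → SkewIndecomposable γ → SkewIndecomposable γ′ → γ ≢ [] → γ′ ≢ [] →
                IsPerm′ β → IsPerm′ β′ → γ ⊖ β ≡ γ′ ⊖ β′ → γ ≡ γ′ × β ≡ β′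
  ⊖-injective {γ} {β} {γ′} {β′} indec indec′ γ≢[] γ′≢[] β-perm β′-perm eq
    with ++-split (map (length β +_) γ) β (map (length β′ +_) γ′) β′ eq
  ... | inj₁ ([] , γ′≡ , refl) = map-injective (+-cancelˡ-≡ (length β) _ _) (sym (trans γ′≡ (++-identityʳ _))) , refl
  ... | inj₂ ([] , γ≡ , refl)  = map-injective (+-cancelˡ-≡ (length β) _ _) (trans γ≡ (++-identityʳ _)) , refl
  ... | inj₁ (_ ∷ _ , γ′≡ , β≡) = ⊥-elim (overlap-absurd indec′ β-perm γ≢[] (λ ()) γ′≡ β≡)
  ... | inj₂ (_ ∷ _ , γ≡ , β′≡) = ⊥-elim (overlap-absurd indec β′-perm γ′≢[] (λ ()) γ≡ β′≡)

  -- Counting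

  module _ {A B : Set} (f : A → List B) where

    length-concatMap : ∀ xs → length (concatMap f xs) ≡ sum (map (length ∘ f) xs)
    length-concatMap []       = refl
    length-concatMap (x ∷ xs) = trans (length-++ (f x)) (cong (length (f x) +_) (length-concatMap xs))

    ∈-concatMap-∃ : ∀ {xs y} → y ∈ concatMap f xs → ∃ λ x → x ∈ xs × y ∈ f x
    ∈-concatMap-∃ = find ∘ ∈-concatMap⁻ f

    ∈-concatMap-intro : ∀ {xs x y} → x ∈ xs → y ∈ f x → y ∈ concatMap f xs
    ∈-concatMap-intro x∈ y∈ = ∈-concatMap⁺ f (lose x∈ y∈)

    unique-concatMap : ∀ {xs} → Unique xs → (∀ {x} → x ∈ xs → Unique (f x)) →
      (∀ {x x′ y} → x ∈ xs → x′ ∈ xs → y ∈ f x → y ∈ f x′ → x ≡ x′) → Unique (concatMap f xs)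
    unique-concatMap {[]}     _           _       _      = []
    unique-concatMap {x ∷ xs} (x∉ ∷ uxs) u-f     shared =
      Unique.++⁺ (u-f (here refl)) (unique-concatMap uxs (u-f ∘ there) λ x∈ x′∈ → shared (there x∈) (there x′∈))
        disjoint
      where
      disjoint : ∀ {y} → y ∈ f x × y ∈ concatMap f xs → ⊥
      disjoint (y∈fx , y∈rest) with x′ , x′∈ , y∈fx′ ← ∈-concatMap-∃ y∈rest =
        All.lookup x∉ x′∈ (shared (here refl) (there x′∈) y∈fx y∈fx′)

  unique-map-on : ∀ {A B : Set} (f : A → B) {xs} → Unique xs →
                  (∀ {x y} → x ∈ xs → y ∈ xs → f x ≡ f y → x ≡ y) → Unique (map f xs)
  unique-map-on f {[]}     _          _   = []
  unique-map-on f {x ∷ xs} (x∉ ∷ uxs) inj =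
    All.map⁺ (All.tabulate λ y∈ fx≡fy → All.lookup x∉ y∈ (inj (here refl) (there y∈) fx≡fy)) ∷
    unique-map-on f uxs λ x∈ y∈ → inj (there x∈) (there y∈)

  sum-map-const : ∀ {A : Set} c (xs : List A) → sum (map (λ _ → c) xs) ≡ length xs * c
  sum-map-const c []       = refl
  sum-map-const c (_ ∷ xs) = cong (c +_) (sum-map-const c xs)

  module Enumeration {Q : List ℕ → Set} {count : ℕ → ℕ} (has : ∀ n → HasCount (Av Q) n (count n)) where

    list : ℕ → List (List ℕ)
    list n = proj₁ (has n)

    unique : ∀ n → Unique (list n)
    unique n = proj₁ (proj₂ (has n))

    length-list : ∀ n → length (list n) ≡ count n
    length-list n = proj₁ (proj₂ (proj₂ (has n)))

    ∈⁺ : ∀ {σ} → Av′ Q σ → σ ∈ list (length σ)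
    ∈⁺ {σ} av = proj₁ (proj₂ (proj₂ (proj₂ (has _))) σ) (Av′⇒Av av , refl)

    ∈⁻ : ∀ {n σ} → σ ∈ list n → Av′ Q σ × length σ ≡ n
    ∈⁻ {n} {σ} σ∈ with av , refl ← proj₂ (proj₂ (proj₂ (proj₂ (has n))) σ) σ∈ = Av⇒Av′ av , refl

    count≡ : ∀ n {L} → Unique L → (∀ {σ} → Av′ Q σ → length σ ≡ n → σ ∈ L) →
             (∀ {σ} → σ ∈ L → Av′ Q σ × length σ ≡ n) →
             count n ≡ length L
    count≡ n u to from = trans (sym (length-list n)) (unique-≋⇒length-≡ (unique n) u
      (λ σ∈ → let av , len = ∈⁻ σ∈ in to av len) from′)
      where
      from′ : ∀ {σ} → σ ∈ _ → σ ∈ list n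
      from′ σ∈ with av , refl ← from σ∈ = ∈⁺ av

    count-zero : (∀ {π} → Q π → 1 ≤ length π) → count 0 ≡ 1
    count-zero nonempty = count≡ 0 ([] ∷ []) (λ {σ} _ len → here (length≡0 σ len))
      λ { (here refl) → Av′-short nonempty (s≤s z≤n) ([] , []) , refl }
      where
      length≡0 : ∀ (σ : List ℕ) → length σ ≡ 0 → σ ≡ []
      length≡0 [] _ = refl

  module Counting (P : List ℕ → Set) (P-nonempty : ∀ ρ → P ρ → ρ ≢ []) (a b : ℕ → ℕ)
    (hasA : ∀ n → HasCount (Av (Base∪ (1⊕Set P))) n (a n)) (hasB : ∀ n → HasCount (Av (Base∪ P)) n (b n)) where

    open Classes P P-nonempty
    module A = Enumeration hasA
    module B = Enumeration hasB

    a-zero : a 0 ≡ 1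
    a-zero = A.count-zero (≤-trans (s≤s z≤n) ∘ QA-length)

    b-zero : b 0 ≡ 1
    b-zero = B.count-zero QB-length

    indecomposablesUpTo : ℕ → ℕ → List (List ℕ)
    indecomposablesUpTo j zero    = []
    indecomposablesUpTo j (suc i) = indecomposablesUpTo j i ++ map (desc⊕ (j ∸ suc (suc i))) (B.list (suc i))

    indecomposables : ℕ → List (List ℕ)
    indecomposables zero          = []
    indecomposables (suc zero)    = (0 ∷ []) ∷ []
    indecomposables (suc (suc i)) = indecomposablesUpTo (suc (suc i)) (suc i)

    ∈-indecomposablesUpTo⁻ : ∀ j i {γ} → γ ∈ indecomposablesUpTo j i →
      ∃₂ λ m τ → 1 ≤ m × m ≤ i × τ ∈ B.list m × γ ≡ desc⊕ (j ∸ suc m) τ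
    ∈-indecomposablesUpTo⁻ j (suc i) γ∈ with ∈-++⁻ (indecomposablesUpTo j i) γ∈
    ... | inj₁ γ∈′ with m , τ , 1≤m , m≤i , τ∈ , refl ← ∈-indecomposablesUpTo⁻ j i γ∈′ =
      m , τ , 1≤m , m≤n⇒m≤1+n m≤i , τ∈ , refl
    ... | inj₂ γ∈′ with τ , τ∈ , refl ← ∈-map⁻ (desc⊕ (j ∸ suc (suc i))) γ∈′ =
      suc i , τ , s≤s z≤n , ≤-refl , τ∈ , refl

    ∈-indecomposablesUpTo⁺ : ∀ j i {m τ} → 1 ≤ m → m ≤ i → τ ∈ B.list m →
                             desc⊕ (j ∸ suc m) τ ∈ indecomposablesUpTo j i
    ∈-indecomposablesUpTo⁺ j zero    (s≤s _) ()
    ∈-indecomposablesUpTo⁺ j (suc i) {m} 1≤m m≤i τ∈ with m ≟ suc i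
    ... | yes refl = ∈-++⁺ʳ (indecomposablesUpTo j i) (∈-map⁺ _ τ∈)
    ... | no  m≢   = ∈-++⁺ˡ (∈-indecomposablesUpTo⁺ j i 1≤m (≤-pred (≤∧≢⇒< m≤i m≢)) τ∈)

    unique-indecomposablesUpTo : ∀ j i → Unique (indecomposablesUpTo j i)
    unique-indecomposablesUpTo j zero    = []
    unique-indecomposablesUpTo j (suc i) =
      Unique.++⁺ (unique-indecomposablesUpTo j i) (Unique.map⁺ (proj₂ ∘ desc⊕-injective) (B.unique (suc i))) disjoint
      where
      disjoint : ∀ {γ} → γ ∈ indecomposablesUpTo j i × γ ∈ map (desc⊕ (j ∸ suc (suc i))) (B.list (suc i)) → ⊥
      disjoint (γ∈ , γ∈′) with _ , _ , _ , m≤i , τ∈ , refl ← ∈-indecomposablesUpTo⁻ j i γ∈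
                          with τ′ , τ′∈ , eq ← ∈-map⁻ (desc⊕ (j ∸ suc (suc i))) γ∈′
                          with refl ← proj₂ (desc⊕-injective eq) =
        <-irrefl (trans (sym (proj₂ (B.∈⁻ τ∈))) (proj₂ (B.∈⁻ τ′∈))) (s≤s m≤i)

    unique-indecomposables : ∀ j → Unique (indecomposables j)
    unique-indecomposables zero          = []
    unique-indecomposables (suc zero)    = [] ∷ []
    unique-indecomposables (suc (suc i)) = unique-indecomposablesUpTo (suc (suc i)) (suc i)

    length-indecomposablesUpTo : ∀ j i → length (indecomposablesUpTo j i) ≡ partialSum b i
    length-indecomposablesUpTo j zero    = refl
    length-indecomposablesUpTo j (suc i) = trans (length-++ (indecomposablesUpTo j i))
      (cong₂ _+_ (length-indecomposablesUpTo j i) (trans (length-map _ (B.list (suc i))) (B.length-list (suc i))))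

    length-indecomposables : ∀ j → length (indecomposables j) ≡ indecomposableCount b j
    length-indecomposables zero          = refl
    length-indecomposables (suc zero)    = refl
    length-indecomposables (suc (suc i)) = length-indecomposablesUpTo (suc (suc i)) (suc i)

    indecomposables-sound : ∀ j {γ} → γ ∈ indecomposables j →
                            Av′ QA γ × length γ ≡ j × SkewIndecomposable γ × γ ≢ []
    indecomposables-sound (suc zero) (here refl) =
      Av′-short QA-length (s≤s (s≤s z≤n)) ([] ∷ [] , s≤s z≤n ∷ []) , refl , skewIndecomposable-[0] , λ ()
    indecomposables-sound (suc (suc i)) γ∈
      with m , τ , 1≤m , m≤i , τ∈ , refl ← ∈-indecomposablesUpTo⁻ (suc (suc i)) (suc i) γ∈
      with τ-av , refl ← B.∈⁻ τ∈ =
      Av-desc⊕ _ τ-av , |γ| , skewIndecomposable-desc⊕ _ τ τ≢[] , λ ()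
      where
      |γ| : length (desc⊕ (suc (suc i) ∸ suc (length τ)) τ) ≡ suc (suc i)
      |γ| = trans (length-desc⊕ _ τ) (trans (sym (+-suc _ (length τ))) (m∸n+n≡m (s≤s m≤i)))
      τ≢[] : τ ≢ []
      τ≢[] τ≡[] with () ← subst (λ l → 1 ≤ length l) τ≡[] 1≤m

    indecomposables-complete : ∀ j {γ} → Av′ QA γ → length γ ≡ j → SkewIndecomposable γ → γ ≢ [] →
                               γ ∈ indecomposables j
    indecomposables-complete zero          {[]}     _                        _    _ γ≢[] = ⊥-elim (γ≢[] refl)
    indecomposables-complete (suc zero)    {_ ∷ []} ((_ , s≤s z≤n ∷ []) , _) refl _ _    = here refl
    indecomposables-complete (suc (suc i)) {γ}      av@(p , avoids)          |γ|  indec _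
      with k , τ , refl , τ≢[] , τ-perm ← indecomposable-shape γ p (subst (2 ≤_) (sym |γ|) (s≤s (s≤s z≤n))) indec
                                            (λ π b → avoids π (Base∪-basis {1⊕Set P} b)) =
      subst (_∈ indecomposablesUpTo (suc (suc i)) (suc i)) (cong (λ k → desc⊕ k τ) k≡)
        (∈-indecomposablesUpTo⁺ (suc (suc i)) (suc i) 1≤τ τ≤i (B.∈⁺ (Av-desc⊕⁻ k av τ-perm)))
      where
      k+τ : suc k + length τ ≡ suc (suc i)
      k+τ = trans (sym (length-desc⊕ k τ)) |γ|
      1≤τ : 1 ≤ length τ
      1≤τ = ≢[]⇒1≤length τ≢[]
      τ≤i : length τ ≤ suc i
      τ≤i = ≤-pred (subst (suc (length τ) ≤_) k+τ (s≤s (m≤n+m (length τ) k)))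
      k≡ : suc (suc i) ∸ suc (length τ) ≡ k
      k≡ = trans (cong (_∸ suc (length τ)) (trans (sym k+τ) (sym (+-suc k (length τ))))) (m+n∸n≡m k (suc (length τ)))

    skewSums : ℕ → ℕ → List (List ℕ)
    skewSums n k = concatMap (λ γ → map (γ ⊖_) (A.list k)) (indecomposables (n ∸ k))

    decompositions : ℕ → List (List ℕ)
    decompositions n = concatMap (skewSums n) (upTo n)

    ∈-decompositions⁻ : ∀ n {σ} → σ ∈ decompositions n →
      ∃ λ k → ∃₂ λ γ β → k < n × γ ∈ indecomposables (n ∸ k) × β ∈ A.list k × σ ≡ γ ⊖ β
    ∈-decompositions⁻ n σ∈ with k , k∈ , σ∈′ ← ∈-concatMap-∃ (skewSums n) σ∈
                           with γ , γ∈ , σ∈″ ← ∈-concatMap-∃ _ σ∈′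
                           with β , β∈ , σ≡ ← ∈-map⁻ (γ ⊖_) σ∈″ =
      k , γ , β , ∈-upTo⁻ k∈ , γ∈ , β∈ , σ≡

    ∈-decompositions⁺ : ∀ n {k γ β} → k < n → γ ∈ indecomposables (n ∸ k) → β ∈ A.list k →
                        γ ⊖ β ∈ decompositions n
    ∈-decompositions⁺ n {k} {γ} k<n γ∈ β∈ = ∈-concatMap-intro (skewSums n) (∈-upTo⁺ k<n)
      (∈-concatMap-intro (λ γ → map (γ ⊖_) (A.list k)) γ∈ (∈-map⁺ (γ ⊖_) β∈))

    ⊖-injective-on : ∀ j j′ {k k′ γ γ′ β β′} → γ ∈ indecomposables j → γ′ ∈ indecomposables j′ →
      β ∈ A.list k → β′ ∈ A.list k′ → γ ⊖ β ≡ γ′ ⊖ β′ → γ ≡ γ′ × β ≡ β′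
    ⊖-injective-on j j′ γ∈ γ′∈ β∈ β′∈ =
      let _ , _ , indec  , γ≢[]  = indecomposables-sound j γ∈
          _ , _ , indec′ , γ′≢[] = indecomposables-sound j′ γ′∈
      in ⊖-injective indec indec′ γ≢[] γ′≢[] (proj₁ (proj₁ (A.∈⁻ β∈))) (proj₁ (proj₁ (A.∈⁻ β′∈)))

    unique-decompositions : ∀ n → Unique (decompositions n)
    unique-decompositions n = unique-concatMap (skewSums n) (Unique.upTo⁺ n) (λ {k} _ → unique-skewSums k) same-k
      where
      unique-skewSums : ∀ k → Unique (skewSums n k)
      unique-skewSums k = unique-concatMap _ (unique-indecomposables (n ∸ k))
        (λ γ∈ → unique-map-on (_ ⊖_) (A.unique k) λ β∈ β′∈ → proj₂ ∘ ⊖-injective-on (n ∸ k) (n ∸ k) γ∈ γ∈ β∈ β′∈)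
        same-γ
        where
        same-γ : ∀ {γ γ′ σ} → γ ∈ indecomposables (n ∸ k) → γ′ ∈ indecomposables (n ∸ k) →
                 σ ∈ map (γ ⊖_) (A.list k) → σ ∈ map (γ′ ⊖_) (A.list k) → γ ≡ γ′
        same-γ {γ} {γ′} γ∈ γ′∈ σ∈ σ∈′
          with β , β∈ , refl ← ∈-map⁻ (γ ⊖_) σ∈ | β′ , β′∈ , eq ← ∈-map⁻ (γ′ ⊖_) σ∈′ =
          proj₁ (⊖-injective-on (n ∸ k) (n ∸ k) γ∈ γ′∈ β∈ β′∈ eq)
      same-k : ∀ {k k′ σ} → k ∈ upTo n → k′ ∈ upTo n → σ ∈ skewSums n k → σ ∈ skewSums n k′ → k ≡ k′
      same-k {k} {k′} _ _ σ∈ σ∈′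
        with γ , γ∈ , σ∈″ ← ∈-concatMap-∃ (λ γ → map (γ ⊖_) (A.list k)) σ∈
           | γ′ , γ′∈ , σ∈‴ ← ∈-concatMap-∃ (λ γ → map (γ ⊖_) (A.list k′)) σ∈′
        with β , β∈ , refl ← ∈-map⁻ (γ ⊖_) σ∈″ | β′ , β′∈ , eq ← ∈-map⁻ (γ′ ⊖_) σ∈‴
        with refl ← proj₂ (⊖-injective-on (n ∸ k) (n ∸ k′) γ∈ γ′∈ β∈ β′∈ eq) =
        trans (sym (proj₂ (A.∈⁻ β∈))) (proj₂ (A.∈⁻ β′∈))

    length-decompositions : ∀ n →
      length (decompositions n) ≡ sum (map (λ k → indecomposableCount b (n ∸ k) * a k) (upTo n))
    length-decompositions n = trans (length-concatMap (skewSums n) (upTo n)) (cong sum (map-cong length-skewSums (upTo n)))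
      where
      length-skewSums : ∀ k → length (skewSums n k) ≡ indecomposableCount b (n ∸ k) * a k
      length-skewSums k = begin
        length (skewSums n k)                                   ≡⟨ length-concatMap _ γs ⟩
        sum (map (λ γ → length (map (γ ⊖_) (A.list k))) γs)
          ≡⟨ cong sum (map-cong (λ γ → trans (length-map (γ ⊖_) (A.list k)) (A.length-list k)) γs) ⟩
        sum (map (λ _ → a k) γs)                                ≡⟨ sum-map-const (a k) γs ⟩
        length γs * a k                                         ≡⟨ cong (_* a k) (length-indecomposables (n ∸ k)) ⟩
        indecomposableCount b (n ∸ k) * a k                     ∎
        where
        open ≡-Reasoning
        γs = indecomposables (n ∸ k)

    a-recurrence : ∀ n → a (suc n) ≡ sum (map (λ k → indecomposableCount b (suc n ∸ k) * a k) (upTo (suc n)))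
    a-recurrence n = trans (A.count≡ (suc n) (unique-decompositions (suc n)) to from) (length-decompositions (suc n))
      where
      to : ∀ {σ} → Av′ QA σ → length σ ≡ suc n → σ ∈ decompositions (suc n)
      to {s ∷ σ} av |σ| with γ , β , σ≡ , γ-perm , β-perm , indec , γ≢[] ← skewDecomposition s σ (proj₁ av) =
        subst (_∈ decompositions (suc n)) (sym σ≡) (∈-decompositions⁺ (suc n) β<n γ∈ (A.∈⁺ (proj₂ γβ-av)))
        where
        γβ-av = Av-⊖⁻ (subst (Av′ QA) σ≡ av) γ-perm β-perm
        γ+β : length γ + length β ≡ suc n
        γ+β = trans (sym (length-⊖ γ β)) (trans (cong length (sym σ≡)) |σ|)
        β<n : length β < suc n
        β<n = subst (length β <_) γ+β (+-monoˡ-≤ (length β) (≢[]⇒1≤length γ≢[]))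
        γ∈ : γ ∈ indecomposables (suc n ∸ length β)
        γ∈ = indecomposables-complete _ (proj₁ γβ-av)
               (sym (trans (cong (_∸ length β) (sym γ+β)) (m+n∸n≡m (length γ) (length β)))) indec γ≢[]
      from : ∀ {σ} → σ ∈ decompositions (suc n) → Av′ QA σ × length σ ≡ suc n
      from σ∈ with k , γ , β , k<n , γ∈ , β∈ , refl ← ∈-decompositions⁻ (suc n) σ∈
              with γ-av , |γ| , _ ← indecomposables-sound (suc n ∸ k) γ∈
              with β-av , refl ← A.∈⁻ β∈ =
        Av-⊖ γ-av β-av , trans (length-⊖ γ β) (trans (cong (_+ length β) |γ|) (m∸n+n≡m (<⇒≤ k<n)))

open import Data.Nat using (ℕ)
open import Data.List using (List; [])
open import Data.Integer using (+_)
open import Data.Product using (_×_; proj₂)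
open import Function using (_∘_)
open import Relation.Binary.PropositionalEquality using (_≡_; _≢_)

corollary5p4 : (P : List ℕ → Set) →
    (∀ ρ → P ρ → IsPerm ρ × ρ ≢ []) →
    (a b : ℕ → ℕ) →
    (∀ n → HasCount (Av (Base∪ (1⊕Set P))) n (a n)) →
    (∀ n → HasCount (Av (Base∪ P)) n (b n)) →
    ∀ n → (ofℕ a ⊛ F-den (ofℕ b ⊖ₛ const (+ 1))) n ≡ F-num n
corollary5p4 P P-perm a b hasA hasB =
  PowerSeries.ofℕ⊛F-den≡F-num a b C.a-zero C.b-zero C.a-recurrence
  where
  module C = PatternAvoidance.Counting P (λ ρ → proj₂ ∘ P-perm ρ) a b hasA hasB
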